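{- Let $\mathcal T'$ be a standard tableau of degree $n\ge4$ and let $\Sigma_{n-4}$ denote the sum of all standard tableaux of degree $n-4$. Then $\mathcal T'$ occurs in $\mathbb B_2^{(0)}\mathbb B_2^{(0)}\Sigma_{n-4}$ iff $\mathcal T'_{\{1,2,3,4\}}\in\{1234,4123,3412\}$; $\mathcal T'$ occurs in $\mathbb B_2^{(0)}\mathbb B_2^{(1)}\Sigma_{n-4}$ iff $\mathcal T'_{\{1,2,3,4\}}\in\{4312,3124\}$; $\mathcal T'$ occurs in $\mathbb B_2^{(1)}\mathbb B_2^{(0)}\Sigma_{n-4}$ iff $\mathcal T'_{\{1,2,3,4\}}\in\{4213,2134\}$; $\mathcal T'$ occurs in $\mathbb B_2^{(1)}\mathbb B_2^{(1)}\Sigma_{n-4}$ iff $\mathcal T'_{\{1,2,3,4\}}\in\{4321,3214,2413\}$.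
   Context: Tableaux: a tableau $(\lambda,w)$ is the diagram of $\lambda$ (French convention, rows from the bottom) filled with the letters of the word $w$ left to right, top row first; $w$ is the reading word. Semi-standard: rows weakly increasing, columns strictly increasing upward; standard: semi-standard with letters $1,\dots,n$ each once. $\mathcal T_S$ is the subword of the reading word consisting of letters in $S$. Transpose $\mathcal T^t$: reflect in the main diagonal. Operators extend linearly to formal sums; "occurs in" means appears as a term of the sum. Products act right to left; word operations act on reading words keeping shape: $\tau_k$ adds $k$ to every letter; $\sigma_i$ ($a=i,b=i+1$), defined when the subword on $\{a,b\}$ has letter counts $(2,1)$ or $(1,2)$, replaces that subword via $aab\leftrightarrow abb$, $aba\leftrightarrow bba$, $baa\leftrightarrow bab$; $r_{(11\to01)}$ replaces the leftmost of exactly two letters $1$ by $0$; $A_{n+1,n+1}$ maps a tableau of degree $n$ to the sum of all tableaux obtained by adding a horizontal strip of two cells filled with $n+1$. $\mathbb B_2^{(0)}\mathcal T=\tau_1r_{(11\to01)}\sigma_1\cdots\sigma_nA_{n+1,n+1}\mathcal T$ for standard $\mathcal T$ of degree $n$; $\mathbb B_2^{(1)}\mathcal T=(\mathbb B_2^{(0)}\mathcal T^t)^t$. -}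

module Defs where

open import Data.Nat using (ℕ; zero; suc; _+_; _≤_; _<_; _≡ᵇ_; _<ᵇ_)
open import Data.Bool using (Bool; true; false; if_then_else_; _∨_; _∧_)
open import Data.List using (List; []; _∷_; _++_; length; reverse; concat; map; take; drop;
  replicate; mapMaybe; head; applyUpTo; filterᵇ)
open import Data.List.Relation.Unary.All using (All)
open import Data.List.Relation.Unary.Linked using (Linked)
open import Data.List.Relation.Binary.Permutation.Propositional using (_↭_)
open import Data.Maybe using (Maybe; just; nothing; _>>=_)
open import Data.Product using (Σ; ∃; _×_; _,_)
open import Data.Unit using (⊤)
open import Data.Empty using (⊥)
open import Relation.Binary.PropositionalEquality using (_≡_)

-- A tableau (λ , w) is represented by its list of rows,
-- BOTTOM row first (French convention), each row read left to right.
-- shape = list of row lengths (bottom first), reading word = rows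
-- concatenated top row first.  (λ , w) ↦ rows is a bijection.

Tableau : Set
Tableau = List (List ℕ)

shape : Tableau → List ℕ
shape t = map length t

readingWord : Tableau → List ℕ
readingWord t = concat (reverse t)

degree : Tableau → ℕ
degree t = length (readingWord t)

fillTop : List ℕ → List ℕ → List (List ℕ)
fillTop []       w = []
fillTop (l ∷ ls) w = take l w ∷ fillTop ls (drop l w)

fill : List ℕ → List ℕ → Tableau
fill λs w = reverse (fillTop (reverse λs) w)

onWord : (List ℕ → Maybe (List ℕ)) → Tableau → Maybe Tableau
onWord f t = f (readingWord t) >>= λ w → just (fill (shape t) w)

-- ColBelow r s : s is the row directly above row r; every cell of s
-- lies above a cell of r (shape is a partition) with strictly larger entry.
ColBelow : List ℕ → List ℕ → Set
ColBelow r       []      = ⊤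
ColBelow []      (_ ∷ _) = ⊥
ColBelow (x ∷ r) (y ∷ s) = x < y × ColBelow r s

NonEmptyRow : List ℕ → Set
NonEmptyRow r = 0 < length r

SemiStandard : Tableau → Set
SemiStandard t = All NonEmptyRow t × All (Linked _≤_) t × Linked ColBelow t

Standard : ℕ → Tableau → Set
Standard n t = SemiStandard t × (readingWord t ↭ applyUpTo suc n)

tau : ℕ → List ℕ → Maybe (List ℕ)
tau k w = just (map (k +_) w)

-- σ_i with a = i, b = i+1.  The subword on {a,b} is coded by Bools
-- (false = a, true = b).
subAB : ℕ → List ℕ → List Bool
subAB i []      = []
subAB i (x ∷ w) =
  if x ≡ᵇ i then false ∷ subAB i w
  else if x ≡ᵇ suc i then true ∷ subAB i w
  else subAB i w

putAB : ℕ → List ℕ → List Bool → List ℕ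
putAB i []      bs = []
putAB i (x ∷ w) [] = x ∷ putAB i w []
putAB i (x ∷ w) (b ∷ bs) =
  if (x ≡ᵇ i) ∨ (x ≡ᵇ suc i)
  then (if b then suc i else i) ∷ putAB i w bs
  else x ∷ putAB i w (b ∷ bs)

sigmaPat : List Bool → Maybe (List Bool)
sigmaPat (false ∷ false ∷ true ∷ []) = just (false ∷ true ∷ true ∷ [])
sigmaPat (false ∷ true ∷ true ∷ [])  = just (false ∷ false ∷ true ∷ [])
sigmaPat (false ∷ true ∷ false ∷ []) = just (true ∷ true ∷ false ∷ [])
sigmaPat (true ∷ true ∷ false ∷ [])  = just (false ∷ true ∷ false ∷ [])
sigmaPat (true ∷ false ∷ false ∷ []) = just (true ∷ false ∷ true ∷ [])
sigmaPat (true ∷ false ∷ true ∷ [])  = just (true ∷ false ∷ false ∷ [])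
sigmaPat _                           = nothing

sigma : ℕ → List ℕ → Maybe (List ℕ)
sigma i w = sigmaPat (subAB i w) >>= λ s → just (putAB i w s)

-- σ_1 σ_2 ⋯ σ_n (acting right to left: σ_n first)
sigmaChain : ℕ → List ℕ → Maybe (List ℕ)
sigmaChain zero    w = just w
sigmaChain (suc n) w = sigma (suc n) w >>= sigmaChain n

replaceFirst1 : List ℕ → List ℕ
replaceFirst1 []      = []
replaceFirst1 (x ∷ w) = if x ≡ᵇ 1 then 0 ∷ w else x ∷ replaceFirst1 w

r11to01 : List ℕ → Maybe (List ℕ)
r11to01 w = if length (filterᵇ (_≡ᵇ 1) w) ≡ᵇ 2 then just (replaceFirst1 w) else nothing

-- HStrip m b t t' k : t' arises from t by appending k cells containing m
-- at the ends of rows (possibly one new top row), such that the new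
-- shape is a partition and the added cells form a horizontal strip:
-- each new row length is ≤ the OLD length b of the row below.

data HStrip (m : ℕ) : ℕ → Tableau → Tableau → ℕ → Set where
  stop   : ∀ {b} → HStrip m b [] [] 0
  newTop : ∀ {b k} → 0 < k → k ≤ b → HStrip m b [] (replicate k m ∷ []) k
  extend : ∀ {b k j r rs rs'} → length r + k ≤ b →
           HStrip m (length r) rs rs' j →
           HStrip m b (r ∷ rs) ((r ++ replicate k m) ∷ rs') (k + j)

bottomLength : Tableau → ℕ
bottomLength []      = 0
bottomLength (r ∷ _) = length r

-- t' is a term of A_{m,m} t  (the bottom row is unconstrained; the bound
-- bottomLength t + 2 is automatically satisfied when adding two cells)
AddStrip2 : ℕ → Tableau → Tableau → Set
AddStrip2 m t t' = HStrip m (bottomLength t + 2) t t' 2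

heads : Tableau → List ℕ
heads t = mapMaybe head t

columns : ℕ → Tableau → Tableau
columns zero    t = []
columns (suc k) t = heads t ∷ columns k (map (drop 1) t)

transposeT : Tableau → Tableau
transposeT t = columns (bottomLength t) t

-- The operators, via "occurs in".  All coefficients are nonnegative
-- integers, so a tableau occurs in a linear combination of such images
-- iff it occurs in the image of one of the summands.

post : ℕ → Tableau → Maybe Tableau
post n u = onWord (λ w → sigmaChain n w >>= r11to01 >>= tau 1) u

OccB0 : Tableau → Tableau → Set
OccB0 t t' = ∃ λ u → AddStrip2 (suc (degree t)) t u × post (degree t) u ≡ just t'

OccB1 : Tableau → Tableau → Set
OccB1 t t' = ∃ λ u → OccB0 (transposeT t) u × t' ≡ transposeT u

OccB : Bool → Tableau → Tableau → Set
OccB false = OccB0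
OccB true  = OccB1

OccBBΣ : Bool → Bool → ℕ → Tableau → Set
OccBBΣ x y m t' = ∃ λ T → Standard m T × ∃ λ u → OccB y T u × OccB x u t'

sub1234 : Tableau → List ℕ
sub1234 t = filterᵇ (λ x → (0 <ᵇ x) ∧ (x <ᵇ 5)) (readingWord t)

{-# OPTIONS --safe #-}
-- Every step of B₂⁽⁰⁾ on a standard tableau T of degree m keeps the tableau semistandard: the strip adds
-- two letters m+1, each σₖ moves the doubled letter one step down, r₍₁₁→₀₁₎ and τ₁ split the two 1s into 1
-- and 2 read in this order. Each step can be undone, so the terms of B₂⁽⁰⁾Σₘ are exactly the standard
-- tableaux of degree m+2 whose reading word has 1 before 2; transposition turns B₂⁽¹⁾ into B₂⁽⁰⁾ and swaps
-- that order. For a term v of B₂⁽⁰⁾u only σ₁, σ₂ and r₍₁₁→₀₁₎ touch letters ≤ 2 of u, so the {1,2}-subword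
-- of u, hence whether u lies in B₂⁽ʸ⁾Σ, is computed from the {1,2,3,4}-subword of v. Thus occurrence in
-- B₂⁽ˣ⁾B₂⁽ʸ⁾Σ depends only on the standard word T′₍₁₂₃₄₎, and the ten such words are checked by evaluation.
module Submission where

open import Defs
open import Data.Nat using (ℕ; zero; suc; pred; _+_; _∸_; _≤_; _<_; _≡ᵇ_; _<ᵇ_; z≤n; s≤s)
open import Data.Nat.Properties
  using (≡ᵇ⇒≡; 1+n≰n; m<1+n⇒m≤n; m≤n⇒m<n∨m≡n; ≤-trans; ≤-refl; ≤-antisym; <⇒≤; <-irrefl; +-suc; +-comm;
         +-identityʳ; m≤m+n; n≤1+n; <-≤-trans; +-monoʳ-≤; m+[n∸m]≡n; m+n≤o⇒m≤o; m+n≤o⇒n≤o; ≤∧≢⇒<; ≰⇒>; n∸n≡0)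
import Data.Nat as ℕ
open import Data.Bool using (Bool; true; false; if_then_else_; not; T; T?; _∧_; _xor_)
open import Data.Bool.Properties using (not-involutive)
open import Data.List
  using (List; []; _∷_; _++_; [_]; length; reverse; concat; concatMap; map; take; drop; head; last;
         replicate; filterᵇ; applyUpTo)
open import Data.List.Properties
  using (∷-injective; ++-conicalˡ; ++-conicalʳ; ++-assoc; ++-identityʳ; reverse-++; reverse-involutive; reverse-map;
         unfold-reverse; concat-++; concat-map; length-++; length-map; length-replicate; length-applyUpTo; take-all; drop-all; drop-drop;
         map-++; map-∘; map-id; map-cong; map-cong-local; map-applyUpTo; applyUpTo-∷ʳ; filter-++)
import Data.List.Properties as List
open import Data.List.Relation.Unary.All using (All; []; _∷_; all?)
import Data.List.Relation.Unary.All as All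
import Data.List.Relation.Unary.All.Properties as All
open import Data.List.Relation.Unary.Any using (here; there)
open import Data.List.Relation.Unary.Linked using (Linked; []; [-]; _∷_; linked?)
import Data.List.Relation.Unary.Linked as Linked
import Data.List.Relation.Unary.Linked.Properties as Linked
open import Data.List.Membership.Propositional using (_∈_)
open import Data.List.Membership.Propositional.Properties using (∈-∃++; ∈-map⁺; ∈-concat⁺′)
open import Data.List.Membership.DecPropositional (List.≡-dec ℕ._≟_) using (_∈?_)
open import Data.List.Relation.Binary.Permutation.Propositional
  using (_↭_; ↭-refl; ↭-sym; ↭-trans; ↭-reflexive; prep; module PermutationReasoning)
open import Data.List.Relation.Binary.Permutation.Propositional.Properties
  using (++⁺ˡ; ++⁺ʳ; ++-comm; shift; shifts; drop-mid; filter-↭; ↭-length; ↭-reverse; ↭-empty-inv;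
         All-resp-↭; ∈-resp-↭)
  renaming (map⁺ to ↭-map⁺)
import Data.Maybe.Properties as Maybe
open import Data.Maybe using (Maybe; just; nothing; _>>=_)
open import Data.Product using (Σ; _×_; _,_; proj₁; proj₂)
open import Data.Sum using (_⊎_; inj₁; inj₂)
open import Data.Empty using (⊥; ⊥-elim)
open import Data.Unit using (⊤; tt)
open import Function using (_∘_)
open import Function.Bundles using (_⇔_; mk⇔)
import Function.Properties.Equivalence as ⇔
open import Relation.Nullary using (Dec; yes; no)
open import Relation.Nullary.Decidable using (_×-dec_; _→-dec_; toWitness)
open import Relation.Binary.PropositionalEquality
  using (_≡_; _≢_; refl; sym; trans; cong; cong₂; subst; subst₂; module ≡-Reasoning)

module Basics where

  >>=-just⁻ : ∀ {A B : Set} (m : Maybe A) (f : A → Maybe B) {y} → (m >>= f) ≡ just y →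
    Σ A λ x → m ≡ just x × f x ≡ just y
  >>=-just⁻ (just x) f eq = x , refl , eq

  true⊎false : (b : Bool) → b ≡ true ⊎ b ≡ false
  true⊎false true  = inj₁ refl
  true⊎false false = inj₂ refl

  ≡ᵇ-true⇒≡ : ∀ {m n} → (m ≡ᵇ n) ≡ true → m ≡ n
  ≡ᵇ-true⇒≡ {m} {n} eq = ≡ᵇ⇒≡ m n (subst T (sym eq) tt)

  ≡ᵇ-refl : ∀ n → (n ≡ᵇ n) ≡ true
  ≡ᵇ-refl zero    = refl
  ≡ᵇ-refl (suc n) = ≡ᵇ-refl n

  ≡ᵇ-false⇒≢ : ∀ {m n} → (m ≡ᵇ n) ≡ false → m ≢ n
  ≡ᵇ-false⇒≢ {m} eq refl with trans (sym eq) (≡ᵇ-refl m)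
  ... | ()

  ≢⇒≡ᵇ-false : ∀ m n → m ≢ n → (m ≡ᵇ n) ≡ false
  ≢⇒≡ᵇ-false m n m≢n with true⊎false (m ≡ᵇ n)
  ... | inj₁ eq = ⊥-elim (m≢n (≡ᵇ-true⇒≡ eq))
  ... | inj₂ eq = eq

  1+n≡ᵇn : ∀ n → (suc n ≡ᵇ n) ≡ false
  1+n≡ᵇn n = ≢⇒≡ᵇ-false (suc n) n (λ eq → <-irrefl (sym eq) ≤-refl)

  n≡ᵇ1+n : ∀ n → (n ≡ᵇ suc n) ≡ false
  n≡ᵇ1+n n = ≢⇒≡ᵇ-false n (suc n) (λ eq → <-irrefl eq ≤-refl)

  below : ℕ → ℕ → Bool
  below k x = x <ᵇ k

  <⇒below : ∀ {x k} → x < k → below k x ≡ true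
  <⇒below {zero}  (s≤s _) = refl
  <⇒below {suc x} (s≤s p) = <⇒below p

  ≤⇒below-false : ∀ {x k} → k ≤ x → below k x ≡ false
  ≤⇒below-false {zero}  z≤n     = refl
  ≤⇒below-false {suc x} z≤n     = refl
  ≤⇒below-false {suc x} (s≤s p) = ≤⇒below-false p

  below-false-mono : ∀ k {x y} → x ≤ y → below k x ≡ false → below k y ≡ false
  below-false-mono zero    {y = zero}  p       e  = refl
  below-false-mono zero    {y = suc _} p       e  = refl
  below-false-mono (suc k) {zero}      p       ()
  below-false-mono (suc k) {suc x}     (s≤s p) e  = below-false-mono k p e

  filterᵇ-accept : ∀ (f : ℕ → Bool) x w → f x ≡ true → filterᵇ f (x ∷ w) ≡ x ∷ filterᵇ f w
  filterᵇ-accept f x w e rewrite e = refl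

  filterᵇ-reject : ∀ (f : ℕ → Bool) x w → f x ≡ false → filterᵇ f (x ∷ w) ≡ filterᵇ f w
  filterᵇ-reject f x w e rewrite e = refl

  filterᵇ-++ : ∀ (f : ℕ → Bool) P Q → filterᵇ f (P ++ Q) ≡ filterᵇ f P ++ filterᵇ f Q
  filterᵇ-++ f = filter-++ (T? ∘ f)

  filterᵇ-concat : ∀ (f : ℕ → Bool) X → filterᵇ f (concat X) ≡ concat (map (filterᵇ f) X)
  filterᵇ-concat f []      = refl
  filterᵇ-concat f (r ∷ X) = trans (filterᵇ-++ f r (concat X)) (cong (filterᵇ f r ++_) (filterᵇ-concat f X))

  filterᵇ-map : ∀ (f : ℕ → Bool) (g : ℕ → ℕ) w → filterᵇ f (map g w) ≡ map g (filterᵇ (f ∘ g) w)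
  filterᵇ-map f g []      = refl
  filterᵇ-map f g (x ∷ w) with true⊎false (f (g x))
  ... | inj₁ e rewrite filterᵇ-accept f (g x) (map g w) e | filterᵇ-accept (f ∘ g) x w e = cong (g x ∷_) (filterᵇ-map f g w)
  ... | inj₂ e rewrite filterᵇ-reject f (g x) (map g w) e | filterᵇ-reject (f ∘ g) x w e = filterᵇ-map f g w

  filterᵇ-cong : ∀ (f h : ℕ → Bool) w → All (λ x → f x ≡ h x) w → filterᵇ f w ≡ filterᵇ h w
  filterᵇ-cong f h []      []       = refl
  filterᵇ-cong f h (x ∷ w) (p ∷ ps) with true⊎false (h x)
  ... | inj₁ e rewrite filterᵇ-accept h x w e | filterᵇ-accept f x w (trans p e) = cong (x ∷_) (filterᵇ-cong f h w ps)
  ... | inj₂ e rewrite filterᵇ-reject h x w e | filterᵇ-reject f x w (trans p e) = filterᵇ-cong f h w ps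

  filterᵇ-filterᵇ : ∀ (f h : ℕ → Bool) w → All (λ x → f x ≡ true → h x ≡ true) w →
    filterᵇ f (filterᵇ h w) ≡ filterᵇ f w
  filterᵇ-filterᵇ f h []      []       = refl
  filterᵇ-filterᵇ f h (x ∷ w) (p ∷ ps) with true⊎false (h x) | true⊎false (f x)
  ... | inj₁ eh | inj₁ ef rewrite filterᵇ-accept h x w eh | filterᵇ-accept f x (filterᵇ h w) ef
    | filterᵇ-accept f x w ef = cong (x ∷_) (filterᵇ-filterᵇ f h w ps)
  ... | inj₁ eh | inj₂ ef rewrite filterᵇ-accept h x w eh | filterᵇ-reject f x (filterᵇ h w) ef
    | filterᵇ-reject f x w ef = filterᵇ-filterᵇ f h w ps
  ... | inj₂ eh | inj₁ ef with trans (sym (p ef)) eh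
  ... | ()
  filterᵇ-filterᵇ f h (x ∷ w) (p ∷ ps) | inj₂ eh | inj₂ ef rewrite filterᵇ-reject h x w eh
    | filterᵇ-reject f x w ef = filterᵇ-filterᵇ f h w ps

  filterᵇ-all : ∀ (f : ℕ → Bool) xs → All (λ x → f x ≡ true) xs → filterᵇ f xs ≡ xs
  filterᵇ-all f []       []       = refl
  filterᵇ-all f (x ∷ xs) (p ∷ ps) = trans (filterᵇ-accept f x xs p) (cong (x ∷_) (filterᵇ-all f xs ps))

  filterᵇ-none : ∀ (f : ℕ → Bool) w → All (λ x → f x ≡ false) w → filterᵇ f w ≡ []
  filterᵇ-none f []      []       = refl
  filterᵇ-none f (x ∷ w) (p ∷ ps) = trans (filterᵇ-reject f x w p) (filterᵇ-none f w ps)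

  last-∷ʳ : ∀ {A : Set} (L : List A) y → last (L ++ [ y ]) ≡ just y
  last-∷ʳ []           y = refl
  last-∷ʳ (x ∷ [])     y = refl
  last-∷ʳ (x ∷ x′ ∷ L) y = last-∷ʳ (x′ ∷ L) y

  last⁻ : ∀ {A : Set} (L : List A) {y} → last L ≡ just y → Σ (List A) λ L₀ → L ≡ L₀ ++ [ y ]
  last⁻ []           ()
  last⁻ (x ∷ [])     refl = [] , refl
  last⁻ (x ∷ x′ ∷ L) e    = let L₀ , eq = last⁻ (x′ ∷ L) e in x ∷ L₀ , cong (x ∷_) eq

  last-reverse : ∀ {A : Set} (D : List A) → last (reverse D) ≡ head D
  last-reverse []      = refl
  last-reverse (d ∷ D) = trans (cong last (unfold-reverse d D)) (last-∷ʳ (reverse D) d)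

  head⁻ : ∀ {A : Set} (R : List A) {y} → head R ≡ just y → Σ (List A) λ R′ → R ≡ y ∷ R′
  head⁻ []      ()
  head⁻ (x ∷ R) refl = R , refl

  head-reverse⁻ : ∀ {A : Set} (U : List A) {z} → head (reverse U) ≡ just z → Σ (List A) λ U′ → U ≡ U′ ++ [ z ]
  head-reverse⁻ U e = last⁻ U (trans (trans (sym (cong last (reverse-involutive U))) (last-reverse (reverse U))) e)

  length-<-++-∷ : ∀ {A : Set} (L₁ : List A) x L₂ → length L₁ < length (L₁ ++ x ∷ L₂)
  length-<-++-∷ []       x L₂ = s≤s z≤n
  length-<-++-∷ (_ ∷ L₁) x L₂ = s≤s (length-<-++-∷ L₁ x L₂)

  All-update : ∀ {A : Set} {P : A → Set} B r r′ C → All P (B ++ r ∷ C) → P r′ → All P (B ++ r′ ∷ C)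
  All-update []      r r′ C (_ ∷ ps) p = p ∷ ps
  All-update (b ∷ B) r r′ C (q ∷ ps) p = q ∷ All-update B r r′ C ps p

  All-middle : ∀ {A : Set} {P : A → Set} B r C → All P (B ++ r ∷ C) → P r
  All-middle B r C ps = All.head (All.++⁻ʳ B ps)

  All-last : ∀ {A : Set} {P : A → Set} B r C {z} → All P (B ++ r ∷ C) → last B ≡ just z → P z
  All-last []           r C ps       ()
  All-last (b ∷ [])     r C (p ∷ _)  refl = p
  All-last (b ∷ b′ ∷ B) r C (_ ∷ ps) e    = All-last (b′ ∷ B) r C ps e

  All-head : ∀ {A : Set} {P : A → Set} B r C {z} → All P (B ++ r ∷ C) → head C ≡ just z → P z
  All-head []      r []      ps           ()
  All-head []      r (c ∷ C) (_ ∷ p ∷ _)  refl = p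
  All-head (b ∷ B) r C       (_ ∷ ps)     e    = All-head B r C ps e

  Linked-last : ∀ {A : Set} {R : A → A → Set} B r C {z} → Linked R (B ++ r ∷ C) → last B ≡ just z → R z r
  Linked-last []           r C l       ()
  Linked-last (b ∷ [])     r C (p ∷ _) refl = p
  Linked-last (b ∷ b′ ∷ B) r C (_ ∷ l) e    = Linked-last (b′ ∷ B) r C l e

  Linked-head : ∀ {A : Set} {R : A → A → Set} B r C {z} → Linked R (B ++ r ∷ C) → head C ≡ just z → R r z
  Linked-head []      r (c ∷ C) (p ∷ _) refl = p
  Linked-head (b ∷ B) r C       l       e    = Linked-head B r C (Linked.tail l) e

  Linked-update : ∀ {A : Set} {R : A → A → Set} B r r′ C → Linked R (B ++ r ∷ C) →
    (∀ {z} → last B ≡ just z → R z r → R z r′) → (∀ {z} → head C ≡ just z → R r z → R r′ z) →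
    Linked R (B ++ r′ ∷ C)
  Linked-update []           r r′ []      l       h₁ h₂ = [-]
  Linked-update []           r r′ (c ∷ C) (p ∷ l) h₁ h₂ = h₂ refl p ∷ l
  Linked-update (b ∷ [])     r r′ C       (p ∷ l) h₁ h₂ = h₁ refl p ∷ Linked-update [] r r′ C l (λ ()) h₂
  Linked-update (b ∷ b′ ∷ B) r r′ C       (p ∷ l) h₁ h₂ = p ∷ Linked-update (b′ ∷ B) r r′ C l h₁ h₂

  Linked-drop1 : ∀ {R : ℕ → ℕ → Set} r → Linked R r → Linked R (drop 1 r)
  Linked-drop1 []          l       = []
  Linked-drop1 (x ∷ [])    l       = []
  Linked-drop1 (x ∷ y ∷ r) (_ ∷ l) = l

  Linked-≤-between : ∀ M u Z v N → Linked _≤_ (M ++ u ∷ Z ++ v ∷ N) → u ≤ v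
  Linked-≤-between (_ ∷ M) u Z       v N l       = Linked-≤-between M u Z v N (Linked.tail l)
  Linked-≤-between []      u []      v N (p ∷ _) = p
  Linked-≤-between []      u (z ∷ Z) v N (p ∷ l) = ≤-trans p (Linked-≤-between [] z Z v N l)

  oneTo : ℕ → List ℕ
  oneTo N = applyUpTo suc N

  All-oneTo : ∀ N → All (λ x → 1 ≤ x × x ≤ N) (oneTo N)
  All-oneTo N = All.applyUpTo⁺₁ suc N (λ p → s≤s z≤n , p)

module Sigma where

  open Basics

  letter : ℕ → Bool → ℕ
  letter i c = if c then suc i else i

  -- σᵢ changes exactly one letter of its alphabet {i, i+1}; the rest of the {i, i+1}-subword is one
  -- of  a∙b, ∙ba, ba∙  where ∙ marks the changed letter.
  data SigmaContext : List Bool → List Bool → Set where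
    a∙b : SigmaContext (false ∷ []) (true ∷ [])
    ∙ba : SigmaContext [] (true ∷ false ∷ [])
    ba∙ : SigmaContext (true ∷ false ∷ []) []

  data LetterClass (i x : ℕ) : Set where
    lower : (x ≡ᵇ i) ≡ true → LetterClass i x
    upper : (x ≡ᵇ i) ≡ false → (x ≡ᵇ suc i) ≡ true → LetterClass i x
    other : (x ≡ᵇ i) ≡ false → (x ≡ᵇ suc i) ≡ false → LetterClass i x

  classify : ∀ i x → LetterClass i x
  classify i x with x ≡ᵇ i in e₁ | x ≡ᵇ suc i in e₂
  ... | true  | _     = lower e₁
  ... | false | true  = upper e₁ e₂
  ... | false | false = other e₁ e₂

  subAB-lower : ∀ i x w → (x ≡ᵇ i) ≡ true → subAB i (x ∷ w) ≡ false ∷ subAB i w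
  subAB-lower i x w e rewrite e = refl

  subAB-upper : ∀ i x w → (x ≡ᵇ i) ≡ false → (x ≡ᵇ suc i) ≡ true → subAB i (x ∷ w) ≡ true ∷ subAB i w
  subAB-upper i x w e e′ rewrite e | e′ = refl

  subAB-other : ∀ i x w → (x ≡ᵇ i) ≡ false → (x ≡ᵇ suc i) ≡ false → subAB i (x ∷ w) ≡ subAB i w
  subAB-other i x w e e′ rewrite e | e′ = refl

  putAB-lower : ∀ i x w b bs → (x ≡ᵇ i) ≡ true → putAB i (x ∷ w) (b ∷ bs) ≡ letter i b ∷ putAB i w bs
  putAB-lower i x w b bs e rewrite e = refl

  putAB-upper : ∀ i x w b bs → (x ≡ᵇ suc i) ≡ true → putAB i (x ∷ w) (b ∷ bs) ≡ letter i b ∷ putAB i w bs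
  putAB-upper i x w b bs e′ with x ≡ᵇ i
  ... | true  = refl
  ... | false rewrite e′ = refl

  putAB-other : ∀ i x w bs → (x ≡ᵇ i) ≡ false → (x ≡ᵇ suc i) ≡ false → putAB i (x ∷ w) bs ≡ x ∷ putAB i w bs
  putAB-other i x w []       e e′ = refl
  putAB-other i x w (b ∷ bs) e e′ rewrite e | e′ = refl

  letter-lower : ∀ i x → (x ≡ᵇ i) ≡ true → letter i false ≡ x
  letter-lower i x e = sym (≡ᵇ-true⇒≡ e)

  letter-upper : ∀ i x → (x ≡ᵇ suc i) ≡ true → letter i true ≡ x
  letter-upper i x e = sym (≡ᵇ-true⇒≡ e)

  subAB-++ : ∀ i P Q → subAB i (P ++ Q) ≡ subAB i P ++ subAB i Q
  subAB-++ i []      Q = refl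
  subAB-++ i (x ∷ P) Q with classify i x
  ... | lower e₁    rewrite subAB-lower i x (P ++ Q) e₁ | subAB-lower i x P e₁ = cong (false ∷_) (subAB-++ i P Q)
  ... | upper e₁ e₂ rewrite subAB-upper i x (P ++ Q) e₁ e₂ | subAB-upper i x P e₁ e₂ = cong (true ∷_) (subAB-++ i P Q)
  ... | other e₁ e₂ rewrite subAB-other i x (P ++ Q) e₁ e₂ | subAB-other i x P e₁ e₂ = subAB-++ i P Q

  subAB-letter : ∀ i c S → subAB i (letter i c ∷ S) ≡ c ∷ subAB i S
  subAB-letter i false S = subAB-lower i i S (≡ᵇ-refl i)
  subAB-letter i true  S = subAB-upper i (suc i) S (1+n≡ᵇn i) (≡ᵇ-refl i)

  subAB-middle : ∀ i P c S → subAB i (P ++ letter i c ∷ S) ≡ subAB i P ++ c ∷ subAB i S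
  subAB-middle i P c S = trans (subAB-++ i P (letter i c ∷ S)) (cong (subAB i P ++_) (subAB-letter i c S))

  putAB-prefix : ∀ i P Q bs → putAB i (P ++ Q) (subAB i P ++ bs) ≡ P ++ putAB i Q bs
  putAB-prefix i []      Q bs = refl
  putAB-prefix i (x ∷ P) Q bs with classify i x
  ... | lower e₁ rewrite subAB-lower i x P e₁ | putAB-lower i x (P ++ Q) false (subAB i P ++ bs) e₁ =
    cong₂ _∷_ (letter-lower i x e₁) (putAB-prefix i P Q bs)
  ... | upper e₁ e₂ rewrite subAB-upper i x P e₁ e₂ | putAB-upper i x (P ++ Q) true (subAB i P ++ bs) e₂ =
    cong₂ _∷_ (letter-upper i x e₂) (putAB-prefix i P Q bs)
  ... | other e₁ e₂ rewrite subAB-other i x P e₁ e₂ | putAB-other i x (P ++ Q) (subAB i P ++ bs) e₁ e₂ =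
    cong (x ∷_) (putAB-prefix i P Q bs)

  putAB-subAB : ∀ i S → putAB i S (subAB i S) ≡ S
  putAB-subAB i []      = refl
  putAB-subAB i (x ∷ S) with classify i x
  ... | lower e₁ rewrite subAB-lower i x S e₁ | putAB-lower i x S false (subAB i S) e₁ =
    cong₂ _∷_ (letter-lower i x e₁) (putAB-subAB i S)
  ... | upper e₁ e₂ rewrite subAB-upper i x S e₁ e₂ | putAB-upper i x S true (subAB i S) e₂ =
    cong₂ _∷_ (letter-upper i x e₂) (putAB-subAB i S)
  ... | other e₁ e₂ rewrite subAB-other i x S e₁ e₂ | putAB-other i x S (subAB i S) e₁ e₂ =
    cong (x ∷_) (putAB-subAB i S)

  putAB-head : ∀ i c d S → putAB i (letter i c ∷ S) (d ∷ subAB i S) ≡ letter i d ∷ S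
  putAB-head i false d S rewrite putAB-lower i i S d (subAB i S) (≡ᵇ-refl i) = cong (letter i d ∷_) (putAB-subAB i S)
  putAB-head i true  d S rewrite putAB-upper i (suc i) S d (subAB i S) (≡ᵇ-refl i) = cong (letter i d ∷_) (putAB-subAB i S)

  putAB-middle : ∀ i P c d S → putAB i (P ++ letter i c ∷ S) (subAB i P ++ d ∷ subAB i S) ≡ P ++ letter i d ∷ S
  putAB-middle i P c d S = trans (putAB-prefix i P _ _) (cong (P ++_) (putAB-head i c d S))

  sigmaPat-context : ∀ {ps qs} → SigmaContext ps qs → ∀ c → sigmaPat (ps ++ c ∷ qs) ≡ just (ps ++ not c ∷ qs)
  sigmaPat-context a∙b false = refl
  sigmaPat-context a∙b true  = refl
  sigmaPat-context ∙ba false = refl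
  sigmaPat-context ∙ba true  = refl
  sigmaPat-context ba∙ false = refl
  sigmaPat-context ba∙ true  = refl

  sigma-toggle : ∀ i P c S → SigmaContext (subAB i P) (subAB i S) →
    sigma i (P ++ letter i c ∷ S) ≡ just (P ++ letter i (not c) ∷ S)
  sigma-toggle i P c S ctx rewrite subAB-middle i P c S | sigmaPat-context ctx c
    | putAB-middle i P c (not c) S = refl

  sigmaPat⁻ : ∀ p q → sigmaPat p ≡ just q →
    Σ (List Bool) λ ps → Σ Bool λ c → Σ (List Bool) λ qs →
      p ≡ ps ++ c ∷ qs × q ≡ ps ++ not c ∷ qs × SigmaContext ps qs
  sigmaPat⁻ (false ∷ false ∷ true ∷ [])  _ refl = _ , _ , _ , refl , refl , a∙b
  sigmaPat⁻ (false ∷ true ∷ true ∷ [])   _ refl = _ , _ , _ , refl , refl , a∙b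
  sigmaPat⁻ (false ∷ true ∷ false ∷ [])  _ refl = [] , _ , _ , refl , refl , ∙ba
  sigmaPat⁻ (true ∷ true ∷ false ∷ [])   _ refl = [] , _ , _ , refl , refl , ∙ba
  sigmaPat⁻ (true ∷ false ∷ false ∷ [])  _ refl = _ ∷ _ ∷ [] , _ , [] , refl , refl , ba∙
  sigmaPat⁻ (true ∷ false ∷ true ∷ [])   _ refl = _ ∷ _ ∷ [] , _ , [] , refl , refl , ba∙
  sigmaPat⁻ []                           _ ()
  sigmaPat⁻ (false ∷ [])                 _ ()
  sigmaPat⁻ (true ∷ [])                  _ ()
  sigmaPat⁻ (false ∷ false ∷ [])         _ ()
  sigmaPat⁻ (false ∷ true ∷ [])          _ ()
  sigmaPat⁻ (true ∷ false ∷ [])          _ ()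
  sigmaPat⁻ (true ∷ true ∷ [])           _ ()
  sigmaPat⁻ (false ∷ false ∷ false ∷ _)  _ ()
  sigmaPat⁻ (true ∷ true ∷ true ∷ _)     _ ()
  sigmaPat⁻ (false ∷ false ∷ true ∷ _ ∷ _) _ ()
  sigmaPat⁻ (false ∷ true ∷ true ∷ _ ∷ _)  _ ()
  sigmaPat⁻ (false ∷ true ∷ false ∷ _ ∷ _) _ ()
  sigmaPat⁻ (true ∷ true ∷ false ∷ _ ∷ _)  _ ()
  sigmaPat⁻ (true ∷ false ∷ false ∷ _ ∷ _) _ ()
  sigmaPat⁻ (true ∷ false ∷ true ∷ _ ∷ _)  _ ()

  subAB-split : ∀ i w ps c qs → subAB i w ≡ ps ++ c ∷ qs →
    Σ (List ℕ) λ P → Σ (List ℕ) λ S → w ≡ P ++ letter i c ∷ S × subAB i P ≡ ps × subAB i S ≡ qs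
  subAB-split i [] [] c qs ()
  subAB-split i [] (_ ∷ _) c qs ()
  subAB-split i (x ∷ w) ps c qs eq with classify i x
  subAB-split i (x ∷ w) [] c qs eq | lower e₁ with ∷-injective (trans (sym (subAB-lower i x w e₁)) eq)
  ... | refl , e = [] , w , cong (_∷ w) (sym (letter-lower i x e₁)) , refl , e
  subAB-split i (x ∷ w) (p ∷ ps) c qs eq | lower e₁ with ∷-injective (trans (sym (subAB-lower i x w e₁)) eq)
  ... | refl , e with subAB-split i w ps c qs e
  ... | P , S , f₁ , f₂ , f₃ = x ∷ P , S , cong (x ∷_) f₁ , trans (subAB-lower i x P e₁) (cong (false ∷_) f₂) , f₃
  subAB-split i (x ∷ w) [] c qs eq | upper e₁ e₂ with ∷-injective (trans (sym (subAB-upper i x w e₁ e₂)) eq)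
  ... | refl , e = [] , w , cong (_∷ w) (sym (letter-upper i x e₂)) , refl , e
  subAB-split i (x ∷ w) (p ∷ ps) c qs eq | upper e₁ e₂ with ∷-injective (trans (sym (subAB-upper i x w e₁ e₂)) eq)
  ... | refl , e with subAB-split i w ps c qs e
  ... | P , S , f₁ , f₂ , f₃ = x ∷ P , S , cong (x ∷_) f₁ , trans (subAB-upper i x P e₁ e₂) (cong (true ∷_) f₂) , f₃
  subAB-split i (x ∷ w) ps c qs eq | other e₁ e₂ with subAB-split i w ps c qs (trans (sym (subAB-other i x w e₁ e₂)) eq)
  ... | P , S , f₁ , f₂ , f₃ = x ∷ P , S , cong (x ∷_) f₁ , trans (subAB-other i x P e₁ e₂) f₂ , f₃

  sigma⁻ : ∀ i w w′ → sigma i w ≡ just w′ →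
    Σ (List ℕ) λ P → Σ Bool λ c → Σ (List ℕ) λ S →
      w ≡ P ++ letter i c ∷ S × w′ ≡ P ++ letter i (not c) ∷ S × SigmaContext (subAB i P) (subAB i S)
  sigma⁻ i w w′ eq with >>=-just⁻ (sigmaPat (subAB i w)) (λ s → just (putAB i w s)) eq
  ... | q , e₁ , refl with sigmaPat⁻ _ _ e₁
  ... | ps , c , qs , ep , refl , ctx with subAB-split i w ps c qs ep
  ... | P , S , refl , refl , refl = P , c , S , refl , putAB-middle i P c (not c) S , ctx

  sigma-involutive : ∀ i w w′ → sigma i w ≡ just w′ → sigma i w′ ≡ just w
  sigma-involutive i w w′ eq with sigma⁻ i w w′ eq
  ... | P , c , S , refl , refl , ctx =
    trans (sigma-toggle i P (not c) S ctx) (cong (λ d → just (P ++ letter i d ∷ S)) (not-involutive c))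

  subAB-filterᵇ : ∀ (f : ℕ → Bool) i w → f i ≡ true → f (suc i) ≡ true → subAB i (filterᵇ f w) ≡ subAB i w
  subAB-filterᵇ f i [] ea eb = refl
  subAB-filterᵇ f i (x ∷ w) ea eb with classify i x
  ... | lower e₁ rewrite filterᵇ-accept f x w (subst (λ z → f z ≡ true) (letter-lower i x e₁) ea)
    | subAB-lower i x w e₁ | subAB-lower i x (filterᵇ f w) e₁ = cong (false ∷_) (subAB-filterᵇ f i w ea eb)
  ... | upper e₁ e₂ rewrite filterᵇ-accept f x w (subst (λ z → f z ≡ true) (letter-upper i x e₂) eb)
    | subAB-upper i x w e₁ e₂ | subAB-upper i x (filterᵇ f w) e₁ e₂ = cong (true ∷_) (subAB-filterᵇ f i w ea eb)
  ... | other e₁ e₂ with true⊎false (f x)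
  ...   | inj₁ e rewrite filterᵇ-accept f x w e | subAB-other i x w e₁ e₂ | subAB-other i x (filterᵇ f w) e₁ e₂ =
    subAB-filterᵇ f i w ea eb
  ...   | inj₂ e rewrite filterᵇ-reject f x w e | subAB-other i x w e₁ e₂ = subAB-filterᵇ f i w ea eb

  at-letter : ∀ (f : ℕ → Bool) i c {b} → f i ≡ b → f (suc i) ≡ b → f (letter i c) ≡ b
  at-letter f i false ea eb = ea
  at-letter f i true  ea eb = eb

  sigma-filterᵇ : ∀ (f : ℕ → Bool) i w w′ → f i ≡ true → f (suc i) ≡ true →
    sigma i w ≡ just w′ → sigma i (filterᵇ f w) ≡ just (filterᵇ f w′)
  sigma-filterᵇ f i w w′ ea eb eq with sigma⁻ i w w′ eq
  ... | P , c , S , refl , refl , ctx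
    rewrite filterᵇ-++ f P (letter i c ∷ S) | filterᵇ-++ f P (letter i (not c) ∷ S)
    | filterᵇ-accept f (letter i c) S (at-letter f i c ea eb) | filterᵇ-accept f (letter i (not c)) S (at-letter f i (not c) ea eb) =
    sigma-toggle i (filterᵇ f P) c (filterᵇ f S)
      (subst₂ SigmaContext (sym (subAB-filterᵇ f i P ea eb)) (sym (subAB-filterᵇ f i S ea eb)) ctx)

  filterᵇ-sigma-outside : ∀ (f : ℕ → Bool) i w w′ → f i ≡ false → f (suc i) ≡ false →
    sigma i w ≡ just w′ → filterᵇ f w′ ≡ filterᵇ f w
  filterᵇ-sigma-outside f i w w′ ea eb eq with sigma⁻ i w w′ eq
  ... | P , c , S , refl , refl , _
    rewrite filterᵇ-++ f P (letter i c ∷ S) | filterᵇ-++ f P (letter i (not c) ∷ S)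
    | filterᵇ-reject f (letter i c) S (at-letter f i c ea eb)
    | filterᵇ-reject f (letter i (not c)) S (at-letter f i (not c) ea eb) = refl

  sigmaChainInv : ℕ → List ℕ → Maybe (List ℕ)
  sigmaChainInv zero    w = just w
  sigmaChainInv (suc n) w = sigmaChainInv n w >>= sigma (suc n)

  sigmaChainInv⇒sigmaChain : ∀ n w w′ → sigmaChainInv n w′ ≡ just w → sigmaChain n w ≡ just w′
  sigmaChainInv⇒sigmaChain zero    w w′ refl = refl
  sigmaChainInv⇒sigmaChain (suc n) w w′ eq with >>=-just⁻ (sigmaChainInv n w′) (sigma (suc n)) eq
  ... | w₀ , e₁ , e₂ rewrite sigma-involutive (suc n) w₀ w e₂ = sigmaChainInv⇒sigmaChain n w₀ w′ e₁

  sigmaChain-split₂ : ∀ k w w₁ → sigmaChain (suc (suc k)) w ≡ just w₁ →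
    Σ (List ℕ) λ w′ → filterᵇ (below 3) w′ ≡ filterᵇ (below 3) w × sigmaChain 2 w′ ≡ just w₁
  sigmaChain-split₂ zero    w w₁ eq = w , refl , eq
  sigmaChain-split₂ (suc k) w w₁ eq with >>=-just⁻ (sigma (suc (suc (suc k))) w) (sigmaChain (suc (suc k))) eq
  ... | w₀ , e₁ , e₂ with sigmaChain-split₂ k w₀ w₁ e₂
  ... | w′ , f₁ , f₂ = w′ , trans f₁ (filterᵇ-sigma-outside (below 3) (suc (suc (suc k))) w w₀ refl refl e₁) , f₂
module Tableaux where

  rw : Tableau → List ℕ
  rw = readingWord

  rw-∷ : ∀ r rs → rw (r ∷ rs) ≡ rw rs ++ r
  rw-∷ r rs = trans (cong concat (unfold-reverse r rs))
    (trans (sym (concat-++ (reverse rs) [ r ])) (cong (rw rs ++_) (++-identityʳ r)))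

  take-length-++ : ∀ (r z : List ℕ) → take (length r) (r ++ z) ≡ r
  take-length-++ []      z = refl
  take-length-++ (x ∷ r) z = cong (x ∷_) (take-length-++ r z)

  drop-length-++ : ∀ (r z : List ℕ) → drop (length r) (r ++ z) ≡ z
  drop-length-++ []      z = refl
  drop-length-++ (x ∷ r) z = drop-length-++ r z

  fillTop-concat : ∀ (rs : List (List ℕ)) → fillTop (map length rs) (concat rs) ≡ rs
  fillTop-concat []       = refl
  fillTop-concat (r ∷ rs) rewrite take-length-++ r (concat rs) | drop-length-++ r (concat rs) =
    cong (r ∷_) (fillTop-concat rs)

  fill-rw : ∀ t → fill (shape t) (rw t) ≡ t
  fill-rw t rewrite sym (reverse-map length t) | fillTop-concat (reverse t) = reverse-involutive t

  fill-rw-sameShape : ∀ t t′ → shape t ≡ shape t′ → fill (shape t) (rw t′) ≡ t′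
  fill-rw-sameShape t t′ e rewrite e = fill-rw t′

  nth : ℕ → List ℕ → Maybe ℕ
  nth k       []      = nothing
  nth zero    (x ∷ r) = just x
  nth (suc k) (x ∷ r) = nth k r

  nth⁻ : ∀ k r {y} → nth k r ≡ just y → Σ (List ℕ) λ M → Σ (List ℕ) λ N → r ≡ M ++ y ∷ N × length M ≡ k
  nth⁻ k       []      ()
  nth⁻ zero    (x ∷ r) refl = [] , r , refl , refl
  nth⁻ (suc k) (x ∷ r) e    with nth⁻ k r e
  ... | M , N , refl , refl = x ∷ M , N , refl , refl

  nth-length : ∀ M y N → nth (length M) (M ++ y ∷ N) ≡ just y
  nth-length []      y N = refl
  nth-length (x ∷ M) y N = nth-length M y N

  nth-++ʳ : ∀ k M Z → nth (length M + k) (M ++ Z) ≡ nth k Z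
  nth-++ʳ k []      Z = refl
  nth-++ʳ k (x ∷ M) Z = nth-++ʳ k M Z

  nth-second : ∀ L y x R₁ R₂ → nth (length L + suc (length R₁)) (L ++ y ∷ R₁ ++ x ∷ R₂) ≡ just x
  nth-second []      y x []       R₂ = refl
  nth-second []      y x (z ∷ R₁) R₂ = nth-second [] z x R₁ R₂
  nth-second (_ ∷ L) y x R₁       R₂ = nth-second L y x R₁ R₂

  nth-< : ∀ k M → k < length M → Σ ℕ λ y → nth k M ≡ just y
  nth-< zero    (x ∷ M) _       = x , refl
  nth-< (suc k) (x ∷ M) (s≤s p) = nth-< k M p

  ColBelow-nth : ∀ r s k {u v} → ColBelow r s → nth k r ≡ just u → nth k s ≡ just v → u < v
  ColBelow-nth r       []      k       c       e₁   ()
  ColBelow-nth []      (y ∷ s) k       ()      e₁   e₂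
  ColBelow-nth (x ∷ r) (y ∷ s) zero    (p , c) refl refl = p
  ColBelow-nth (x ∷ r) (y ∷ s) (suc k) (p , c) e₁   e₂   = ColBelow-nth r s k c e₁ e₂

  ColBelow-nth-below : ∀ r s k {v} → ColBelow r s → nth k s ≡ just v → Σ ℕ λ u → nth k r ≡ just u
  ColBelow-nth-below r       []      k       c       ()
  ColBelow-nth-below []      (y ∷ s) k       ()      e
  ColBelow-nth-below (x ∷ r) (y ∷ s) zero    c       e = x , refl
  ColBelow-nth-below (x ∷ r) (y ∷ s) (suc k) (p , c) e = ColBelow-nth-below r s k c e

  ColBelow-update-upper : ∀ r L x x′ R → ColBelow r (L ++ x ∷ R) →
    (∀ {y} → nth (length L) r ≡ just y → y < x′) → ColBelow r (L ++ x′ ∷ R)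
  ColBelow-update-upper []      []      x x′ R ()      h
  ColBelow-update-upper (z ∷ r) []      x x′ R (p , c) h = h refl , c
  ColBelow-update-upper []      (l ∷ L) x x′ R ()      h
  ColBelow-update-upper (z ∷ r) (l ∷ L) x x′ R (p , c) h = p , ColBelow-update-upper r L x x′ R c h

  ColBelow-update-lower : ∀ s L x x′ R → ColBelow (L ++ x ∷ R) s →
    (∀ {y} → nth (length L) s ≡ just y → x′ < y) → ColBelow (L ++ x′ ∷ R) s
  ColBelow-update-lower []      L       x x′ R c       h = tt
  ColBelow-update-lower (z ∷ s) []      x x′ R (p , c) h = h refl , c
  ColBelow-update-lower (z ∷ s) (l ∷ L) x x′ R (p , c) h = p , ColBelow-update-lower s L x x′ R c h

module CellUpdate where

  open Basics
  open Tableaux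

  SemiStandard-update : ∀ B L x x′ R A → SemiStandard (B ++ (L ++ x ∷ R) ∷ A) →
    (∀ {y} → last L ≡ just y → y ≤ x′) → (∀ {y} → head R ≡ just y → x′ ≤ y) →
    (∀ {z} → last B ≡ just z → ∀ {y} → nth (length L) z ≡ just y → y < x′) →
    (∀ {z} → head A ≡ just z → ∀ {y} → nth (length L) z ≡ just y → x′ < y) →
    SemiStandard (B ++ (L ++ x′ ∷ R) ∷ A)
  SemiStandard-update B L x x′ R A (ne , rows , cols) h₁ h₂ h₃ h₄ =
    All-update B _ _ A ne (nonEmpty L) ,
    All-update B _ _ A rows (Linked-update L x x′ R (All-middle B _ A rows) (λ e _ → h₁ e) (λ e _ → h₂ e)) ,
    Linked-update B _ _ A cols (λ e c → ColBelow-update-upper _ L x x′ R c (h₃ e))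
                               (λ e c → ColBelow-update-lower _ L x x′ R c (h₄ e))
    where
    nonEmpty : ∀ L → NonEmptyRow (L ++ x′ ∷ R)
    nonEmpty []      = s≤s z≤n
    nonEmpty (_ ∷ _) = s≤s z≤n

  ++-≡-∷⁻ : ∀ (r Z P : List ℕ) x S → r ++ Z ≡ P ++ x ∷ S →
    (Σ (List ℕ) λ L → Σ (List ℕ) λ R → r ≡ L ++ x ∷ R × P ≡ L × S ≡ R ++ Z) ⊎
    (Σ (List ℕ) λ P′ → P ≡ r ++ P′ × Z ≡ P′ ++ x ∷ S)
  ++-≡-∷⁻ []      Z P       x S e    = inj₂ (P , refl , e)
  ++-≡-∷⁻ (y ∷ r) Z []      x S refl = inj₁ ([] , r , refl , refl , refl)
  ++-≡-∷⁻ (y ∷ r) Z (p ∷ P) x S e    with ∷-injective e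
  ... | refl , e′ with ++-≡-∷⁻ r Z P x S e′
  ... | inj₁ (L , R , e₁ , e₂ , e₃) = inj₁ (y ∷ L , R , cong (y ∷_) e₁ , cong (y ∷_) e₂ , e₃)
  ... | inj₂ (P′ , e₁ , e₂)         = inj₂ (P′ , cong (y ∷_) e₁ , e₂)

  concat-≡-∷⁻ : ∀ (rs : List (List ℕ)) P x S → concat rs ≡ P ++ x ∷ S →
    Σ (List (List ℕ)) λ U → Σ (List ℕ) λ L → Σ (List ℕ) λ R → Σ (List (List ℕ)) λ D →
      rs ≡ U ++ (L ++ x ∷ R) ∷ D × P ≡ concat U ++ L × S ≡ R ++ concat D
  concat-≡-∷⁻ []       []      x S ()
  concat-≡-∷⁻ []       (_ ∷ _) x S ()
  concat-≡-∷⁻ (r ∷ rs) P       x S e with ++-≡-∷⁻ r (concat rs) P x S e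
  ... | inj₁ (L , R , refl , refl , refl) = [] , L , R , rs , refl , refl , refl
  ... | inj₂ (P′ , refl , e₂) with concat-≡-∷⁻ rs P′ x S e₂
  ... | U , L , R , D , refl , refl , refl = r ∷ U , L , R , D , refl , sym (++-assoc r (concat U) L) , refl

  reverse-middle : ∀ {A : Set} (U : List A) r D → reverse (U ++ r ∷ D) ≡ reverse D ++ r ∷ reverse U
  reverse-middle U r D = trans (reverse-++ U (r ∷ D))
    (trans (cong (_++ reverse U) (unfold-reverse r D)) (++-assoc (reverse D) [ r ] (reverse U)))

  rw-middle : ∀ U L x R D → rw (reverse D ++ (L ++ x ∷ R) ∷ reverse U) ≡ (concat U ++ L) ++ x ∷ (R ++ concat D)
  rw-middle U L x R D = begin
    concat (reverse (reverse D ++ (L ++ x ∷ R) ∷ reverse U))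
      ≡⟨ cong concat (trans (reverse-middle (reverse D) _ (reverse U))
                            (cong₂ (λ a b → a ++ (L ++ x ∷ R) ∷ b) (reverse-involutive U) (reverse-involutive D))) ⟩
    concat (U ++ (L ++ x ∷ R) ∷ D)         ≡⟨ sym (concat-++ U ((L ++ x ∷ R) ∷ D)) ⟩
    concat U ++ (L ++ x ∷ R) ++ concat D   ≡⟨ cong (concat U ++_) (++-assoc L (x ∷ R) (concat D)) ⟩
    concat U ++ L ++ x ∷ R ++ concat D     ≡⟨ sym (++-assoc (concat U) L _) ⟩
    (concat U ++ L) ++ x ∷ (R ++ concat D) ∎
    where open ≡-Reasoning

  shape-middle : ∀ B L x x′ R A → shape (B ++ (L ++ x ∷ R) ∷ A) ≡ shape (B ++ (L ++ x′ ∷ R) ∷ A)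
  shape-middle B L x x′ R A rewrite map-++ length B ((L ++ x ∷ R) ∷ A) | map-++ length B ((L ++ x′ ∷ R) ∷ A)
    | length-++ L {x ∷ R} | length-++ L {x′ ∷ R} = refl

  rw-cell : ∀ t P x S → rw t ≡ P ++ x ∷ S →
    Σ (List (List ℕ)) λ U → Σ (List ℕ) λ L → Σ (List ℕ) λ R → Σ (List (List ℕ)) λ D →
      t ≡ reverse D ++ (L ++ x ∷ R) ∷ reverse U × P ≡ concat U ++ L × S ≡ R ++ concat D
  rw-cell t P x S e with concat-≡-∷⁻ (reverse t) P x S e
  ... | U , L , R , D , e′ , refl , refl =
    U , L , R , D , trans (sym (reverse-involutive t)) (trans (cong reverse e′) (reverse-middle U _ D)) , refl , refl

  above-in-prefix : ∀ U L k {z y} → head (reverse U) ≡ just z → nth k z ≡ just y →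
    Σ (List (List ℕ)) λ U′ → Σ (List ℕ) λ M → Σ (List ℕ) λ N →
      concat U ++ L ≡ (concat U′ ++ M) ++ y ∷ (N ++ L) × z ≡ M ++ y ∷ N × length M ≡ k
  above-in-prefix U L k {z} {y} ez ey with head-reverse⁻ U ez | nth⁻ k z ey
  ... | U′ , refl | M , N , refl , len = U′ , M , N , prefix , refl , len
    where
    prefix : concat (U′ ++ [ M ++ y ∷ N ]) ++ L ≡ (concat U′ ++ M) ++ y ∷ (N ++ L)
    prefix rewrite sym (concat-++ U′ [ M ++ y ∷ N ]) | ++-identityʳ (M ++ y ∷ N)
      | ++-assoc (concat U′) (M ++ y ∷ N) L | ++-assoc M (y ∷ N) L = sym (++-assoc (concat U′) M (y ∷ N ++ L))

  below-in-suffix : ∀ R D k {z y} → last (reverse D) ≡ just z → nth k z ≡ just y →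
    Σ (List (List ℕ)) λ D′ → Σ (List ℕ) λ M → Σ (List ℕ) λ N →
      R ++ concat D ≡ (R ++ M) ++ y ∷ (N ++ concat D′) × z ≡ M ++ y ∷ N × length M ≡ k
  below-in-suffix R D k {z} {y} ez ey with head⁻ D (trans (sym (last-reverse D)) ez) | nth⁻ k z ey
  ... | D′ , refl | M , N , refl , len = D′ , M , N , suffix , refl , len
    where
    suffix : R ++ concat ((M ++ y ∷ N) ∷ D′) ≡ (R ++ M) ++ y ∷ (N ++ concat D′)
    suffix rewrite ++-assoc M (y ∷ N) (concat D′) = sym (++-assoc R M (y ∷ N ++ concat D′))

  update-cell : ∀ t P x S x′ → SemiStandard t → rw t ≡ P ++ x ∷ S →
    All (λ y → y ≤ x → y ≤ x′) P → All (λ y → x ≤ y → x′ ≤ y) S →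
    All (λ y → y < x → y < x′) S → All (λ y → x < y → x′ < y) P →
    Σ Tableau λ t′ → SemiStandard t′ × rw t′ ≡ P ++ x′ ∷ S × shape t′ ≡ shape t
  update-cell t P x S x′ ss e c₁ c₂ c₃ c₄ with rw-cell t P x S e
  ... | U , L , R , D , refl , refl , refl =
    _ , SemiStandard-update B L x x′ R A ss h₁ h₂ h₃ h₄ , rw-middle U L x′ R D , sym (shape-middle B L x x′ R A)
    where
    B = reverse D
    A = reverse U
    row : Linked _≤_ (L ++ x ∷ R)
    row = All-middle B _ A (proj₁ (proj₂ ss))
    h₁ : ∀ {y} → last L ≡ just y → y ≤ x′
    h₁ {y} e with last⁻ L e
    ... | L₀ , refl = All-middle (concat U ++ L₀) y []
      (subst (All _) (sym (++-assoc (concat U) L₀ [ y ])) c₁) (Linked-last L x R row e)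
    h₂ : ∀ {y} → head R ≡ just y → x′ ≤ y
    h₂ {y} e with head⁻ R e
    ... | R′ , refl = All.head c₂ (Linked-head L x R row e)
    h₃ : ∀ {z} → last B ≡ just z → ∀ {y} → nth (length L) z ≡ just y → y < x′
    h₃ {z} ez {y} ey with below-in-suffix R D (length L) ez ey
    ... | D′ , M , N , eS , _ , _ = All-middle (R ++ M) y (N ++ concat D′) (subst (All _) eS c₃)
      (ColBelow-nth z _ (length L) (Linked-last B _ A (proj₂ (proj₂ ss)) ez) ey (nth-length L x R))
    h₄ : ∀ {z} → head A ≡ just z → ∀ {y} → nth (length L) z ≡ just y → x′ < y
    h₄ {z} ez {y} ey with above-in-prefix U L (length L) ez ey
    ... | U′ , M , N , eP , _ , _ = All-middle (concat U′ ++ M) y (N ++ L) (subst (All _) eP c₄)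
      (ColBelow-nth _ z (length L) (Linked-head B _ A (proj₂ (proj₂ ss)) ez) (nth-length L x R) ey)

module Counting where

  open Basics
  open Sigma

  mult : ℕ → List ℕ → ℕ
  mult x w = length (filterᵇ (_≡ᵇ x) w)

  mult-++ : ∀ x P Q → mult x (P ++ Q) ≡ mult x P + mult x Q
  mult-++ x P Q rewrite filterᵇ-++ (_≡ᵇ x) P Q = length-++ (filterᵇ (_≡ᵇ x) P)

  mult-↭ : ∀ x {w w′} → w ↭ w′ → mult x w ≡ mult x w′
  mult-↭ x p = ↭-length (filter-↭ _ p)

  mult-here : ∀ x w → mult x (x ∷ w) ≡ suc (mult x w)
  mult-here x w rewrite filterᵇ-accept (_≡ᵇ x) x w (≡ᵇ-refl x) = refl

  mult-other : ∀ x y w → (y ≡ᵇ x) ≡ false → mult x (y ∷ w) ≡ mult x w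
  mult-other x y w e rewrite filterᵇ-reject (_≡ᵇ x) y w e = refl

  mult-∷-≤ : ∀ z x w → mult z w ≤ mult z (x ∷ w)
  mult-∷-≤ z x w with true⊎false (x ≡ᵇ z)
  ... | inj₁ e rewrite filterᵇ-accept (_≡ᵇ z) x w e = n≤1+n _
  ... | inj₂ e rewrite filterᵇ-reject (_≡ᵇ z) x w e = ≤-refl

  mult-oneTo-snoc : ∀ x N → mult x (oneTo (suc N)) ≡ mult x (oneTo N) + mult x [ suc N ]
  mult-oneTo-snoc x N = trans (cong (mult x) (sym (applyUpTo-∷ʳ suc N))) (mult-++ x (oneTo N) [ suc N ])

  mult-oneTo-> : ∀ x N → N < x → mult x (oneTo N) ≡ 0
  mult-oneTo-> x zero    p = refl
  mult-oneTo-> x (suc N) p rewrite mult-oneTo-snoc x N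
    | mult-other x (suc N) [] (≢⇒≡ᵇ-false (suc N) x (λ e → <-irrefl e p))
    | mult-oneTo-> x N (≤-trans (n≤1+n _) p) = refl

  mult-oneTo-0 : ∀ N → mult 0 (oneTo N) ≡ 0
  mult-oneTo-0 zero    = refl
  mult-oneTo-0 (suc N) rewrite mult-oneTo-snoc 0 N | mult-oneTo-0 N = refl

  mult-oneTo-∈ : ∀ x N → 1 ≤ x → x ≤ N → mult x (oneTo N) ≡ 1
  mult-oneTo-∈ (suc _) zero p ()
  mult-oneTo-∈ x (suc N) p q rewrite mult-oneTo-snoc x N with x ℕ.≟ suc N
  ... | yes refl rewrite mult-oneTo-> (suc N) N ≤-refl | mult-here (suc N) [] = refl
  ... | no x≢1+N rewrite mult-other x (suc N) [] (≢⇒≡ᵇ-false (suc N) x (λ e → x≢1+N (sym e)))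
    | mult-oneTo-∈ x N p (m<1+n⇒m≤n (≤∧≢⇒< q x≢1+N)) = refl

  mult-oneTo-≤1 : ∀ x N → mult x (oneTo N) ≤ 1
  mult-oneTo-≤1 zero    N rewrite mult-oneTo-0 N = z≤n
  mult-oneTo-≤1 (suc x) N with suc x ℕ.≤? N
  ... | yes p rewrite mult-oneTo-∈ (suc x) N (s≤s z≤n) p = ≤-refl
  ... | no ¬p rewrite mult-oneTo-> (suc x) N (≰⇒> ¬p) = z≤n

  multᵇ : Bool → List Bool → ℕ
  multᵇ c           []           = 0
  multᵇ false       (false ∷ bs) = suc (multᵇ false bs)
  multᵇ false       (true ∷ bs)  = multᵇ false bs
  multᵇ true        (true ∷ bs)  = suc (multᵇ true bs)
  multᵇ true        (false ∷ bs) = multᵇ true bs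

  mult-subAB : ∀ i c w → mult (letter i c) w ≡ multᵇ c (subAB i w)
  mult-subAB i c     []      = refl
  mult-subAB i c     (x ∷ w) with classify i x
  mult-subAB i false (x ∷ w) | lower e₁ rewrite subAB-lower i x w e₁ | sym (letter-lower i x e₁) | mult-here i w =
    cong suc (mult-subAB i false w)
  mult-subAB i true  (x ∷ w) | lower e₁ rewrite subAB-lower i x w e₁ | sym (letter-lower i x e₁)
    | mult-other (suc i) i w (n≡ᵇ1+n i) = mult-subAB i true w
  mult-subAB i false (x ∷ w) | upper e₁ e₂ rewrite subAB-upper i x w e₁ e₂ | mult-other i x w e₁ = mult-subAB i false w
  mult-subAB i true  (x ∷ w) | upper e₁ e₂ rewrite subAB-upper i x w e₁ e₂ | sym (letter-upper i x e₂)
    | mult-here (suc i) w = cong suc (mult-subAB i true w)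
  mult-subAB i false (x ∷ w) | other e₁ e₂ rewrite subAB-other i x w e₁ e₂ | mult-other i x w e₁ = mult-subAB i false w
  mult-subAB i true  (x ∷ w) | other e₁ e₂ rewrite subAB-other i x w e₁ e₂ | mult-other (suc i) x w e₂ =
    mult-subAB i true w

  SigmaContext-multᵇ : ∀ {ps qs} → SigmaContext ps qs → ∀ c → multᵇ c (ps ++ c ∷ qs) ≡ 2
  SigmaContext-multᵇ a∙b false = refl
  SigmaContext-multᵇ a∙b true  = refl
  SigmaContext-multᵇ ∙ba false = refl
  SigmaContext-multᵇ ∙ba true  = refl
  SigmaContext-multᵇ ba∙ false = refl
  SigmaContext-multᵇ ba∙ true  = refl

  mult-toggled : ∀ i P c S → SigmaContext (subAB i P) (subAB i S) → mult (letter i c) (P ++ letter i c ∷ S) ≡ 2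
  mult-toggled i P c S ctx rewrite mult-subAB i c (P ++ letter i c ∷ S) | subAB-middle i P c S =
    SigmaContext-multᵇ ctx c

  -- σᵢ changes the letter that occurs twice, so with the content {c} ∪ L and a single letter ¬c it
  -- turns a c into ¬c.
  sigma-↭ : ∀ i c w w′ L → sigma i w ≡ just w′ → w ↭ letter i c ∷ L → mult (letter i (not c)) w ≡ 1 →
    w′ ↭ letter i (not c) ∷ L
  sigma-↭ i c w w′ L eq p once with sigma⁻ i w w′ eq
  sigma-↭ i false w w′ L eq p once | P , false , S , refl , refl , ctx = ↭-trans (shift _ P S) (prep _ (drop-mid P [] p))
  sigma-↭ i true  w w′ L eq p once | P , true  , S , refl , refl , ctx = ↭-trans (shift _ P S) (prep _ (drop-mid P [] p))
  sigma-↭ i false w w′ L eq p once | P , true  , S , refl , refl , ctx with trans (sym once) (mult-toggled i P true S ctx)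
  ... | ()
  sigma-↭ i true  w w′ L eq p once | P , false , S , refl , refl , ctx with trans (sym once) (mult-toggled i P false S ctx)
  ... | ()

  sigmaPat-defined : ∀ p → multᵇ false p ≡ 2 → multᵇ true p ≡ 1 → Σ (List Bool) λ q → sigmaPat p ≡ just q
  sigmaPat-defined []                                 ()  _
  sigmaPat-defined (false ∷ [])                       ()  _
  sigmaPat-defined (true ∷ [])                        ()  _
  sigmaPat-defined (false ∷ false ∷ [])               _   ()
  sigmaPat-defined (false ∷ true ∷ [])                ()  _
  sigmaPat-defined (true ∷ false ∷ [])                ()  _
  sigmaPat-defined (true ∷ true ∷ _)                  _   ()
  sigmaPat-defined (false ∷ false ∷ false ∷ _)        ()  _
  sigmaPat-defined (false ∷ false ∷ true ∷ [])        _   _ = _ , refl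
  sigmaPat-defined (false ∷ false ∷ true ∷ false ∷ _) ()  _
  sigmaPat-defined (false ∷ false ∷ true ∷ true ∷ _)  _   ()
  sigmaPat-defined (false ∷ true ∷ false ∷ [])        _   _ = _ , refl
  sigmaPat-defined (false ∷ true ∷ false ∷ false ∷ _) ()  _
  sigmaPat-defined (false ∷ true ∷ false ∷ true ∷ _)  _   ()
  sigmaPat-defined (false ∷ true ∷ true ∷ _)          _   ()
  sigmaPat-defined (true ∷ false ∷ false ∷ [])        _   _ = _ , refl
  sigmaPat-defined (true ∷ false ∷ false ∷ false ∷ _) ()  _
  sigmaPat-defined (true ∷ false ∷ false ∷ true ∷ _)  _   ()
  sigmaPat-defined (true ∷ false ∷ true ∷ _)          _   ()

  sigma-defined : ∀ i w → mult i w ≡ 2 → mult (suc i) w ≡ 1 → Σ (List ℕ) λ w′ → sigma i w ≡ just w′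
  sigma-defined i w e₁ e₂
    with sigmaPat-defined (subAB i w) (trans (sym (mult-subAB i false w)) e₁) (trans (sym (mult-subAB i true w)) e₂)
  ... | q , eq rewrite eq = putAB i w q , refl

module SigmaSemiStandard where

  open Basics
  open Sigma
  open Tableaux
  open CellUpdate

  b-in-ba : ∀ (Z W : List Bool) → Z ++ true ∷ W ≡ true ∷ false ∷ [] → Z ≡ [] × W ≡ false ∷ []
  b-in-ba []                    W refl = refl , refl
  b-in-ba (true ∷ [])           W ()
  b-in-ba (true ∷ true ∷ Z)     W ()
  b-in-ba (true ∷ false ∷ [])   W ()
  b-in-ba (true ∷ false ∷ _ ∷ _) W ()
  b-in-ba (false ∷ Z)           W ()

  a-in-ba : ∀ (Z W : List Bool) → Z ++ false ∷ W ≡ true ∷ false ∷ [] → Z ≡ true ∷ [] × W ≡ []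
  a-in-ba []                    W ()
  a-in-ba (true ∷ [])           W refl = refl , refl
  a-in-ba (true ∷ true ∷ Z)     W ()
  a-in-ba (true ∷ false ∷ [])   W ()
  a-in-ba (true ∷ false ∷ _ ∷ _) W ()
  a-in-ba (false ∷ Z)           W ()

  ++-≡-[_]⁻ : ∀ {A : Set} c (Z W : List A) → Z ++ W ≡ [ c ] → (Z ≡ [ c ] × W ≡ []) ⊎ (Z ≡ [] × W ≡ [ c ])
  ++-≡-[ c ]⁻ []          W e  = inj₂ (refl , e)
  ++-≡-[ c ]⁻ (z ∷ [])    [] e = inj₁ (e , refl)
  ++-≡-[ c ]⁻ (z ∷ [])    (_ ∷ _) ()
  ++-≡-[ c ]⁻ (z ∷ _ ∷ _) W ()

  subAB-≢-[] : ∀ i M c N → subAB i (M ++ letter i c ∷ N) ≢ []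
  subAB-≢-[] i M c N e with ++-conicalʳ (subAB i M) _ (trans (sym (subAB-middle i M c N)) e)
  ... | ()

  SigmaContext-b-before : ∀ {ps qs} → SigmaContext ps qs → ∀ Z W → ps ≡ Z ++ true ∷ W → ps ≡ true ∷ false ∷ []
  SigmaContext-b-before a∙b []            W ()
  SigmaContext-b-before a∙b (false ∷ [])  W ()
  SigmaContext-b-before a∙b (false ∷ _ ∷ _) W ()
  SigmaContext-b-before a∙b (true ∷ _)    W ()
  SigmaContext-b-before ∙ba []            W ()
  SigmaContext-b-before ∙ba (_ ∷ _)       W ()
  SigmaContext-b-before ba∙ Z             W e = refl

  SigmaContext-a-after : ∀ {ps qs} → SigmaContext ps qs → ∀ Z W → qs ≡ Z ++ false ∷ W → qs ≡ true ∷ false ∷ []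
  SigmaContext-a-after a∙b []           W ()
  SigmaContext-a-after a∙b (true ∷ [])  W ()
  SigmaContext-a-after a∙b (true ∷ _ ∷ _) W ()
  SigmaContext-a-after a∙b (false ∷ _)  W ()
  SigmaContext-a-after ∙ba Z            W e = refl
  SigmaContext-a-after ba∙ []           W ()
  SigmaContext-a-after ba∙ (_ ∷ _)      W ()

  SigmaContext-¬b-last : ∀ {ps qs} → SigmaContext ps qs → ∀ Z → ps ≢ Z ++ [ true ]
  SigmaContext-¬b-last a∙b []          ()
  SigmaContext-¬b-last a∙b (_ ∷ [])    ()
  SigmaContext-¬b-last a∙b (_ ∷ _ ∷ _) ()
  SigmaContext-¬b-last ∙ba []          ()
  SigmaContext-¬b-last ∙ba (_ ∷ _)     ()
  SigmaContext-¬b-last ba∙ []          ()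
  SigmaContext-¬b-last ba∙ (_ ∷ [])    ()
  SigmaContext-¬b-last ba∙ (_ ∷ _ ∷ []) ()
  SigmaContext-¬b-last ba∙ (_ ∷ _ ∷ _ ∷ _) ()

  SigmaContext-¬a-first : ∀ {ps qs} → SigmaContext ps qs → ∀ W → qs ≢ false ∷ W
  SigmaContext-¬a-first a∙b W ()
  SigmaContext-¬a-first ∙ba W ()
  SigmaContext-¬a-first ba∙ W ()

  -- Raising a letter i to i+1 while the cell above holds i+1: the only context with a b before the
  -- changed cell is ba∙, whose a would have to lie in the row above (impossible, that row is ≥ i+1
  -- after the b) or left of the cell in its own row (then the cell above it is another b).
  upper-above-lower : ∀ i U′ M N L R → subAB i ((U′ ++ M) ++ letter i true ∷ (N ++ L)) ≡ true ∷ false ∷ [] →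
    Linked _≤_ (M ++ suc i ∷ N) → ColBelow (L ++ i ∷ R) (M ++ suc i ∷ N) → length M ≡ length L → ⊥
  upper-above-lower i U′ M N L R e sorted cb len
    with b-in-ba _ _ (trans (sym (subAB-middle i (U′ ++ M) true (N ++ L))) e)
  ... | e₁ , e₂ with ++-≡-[ false ]⁻ (subAB i N) (subAB i L) (trans (sym (subAB-++ i N L)) e₂)
  ... | inj₁ (eN , _) with subAB-split i N [] false [] eN
  ...   | N₁ , N₂ , refl , _ , _ = 1+n≰n (Linked-≤-between M (suc i) N₁ i N₂ sorted)
  upper-above-lower i U′ M N L R e sorted cb len | e₁ , e₂ | inj₂ (_ , eL) with subAB-split i L [] false [] eL
  ...   | L₁ , L₂ , refl , _ , _ with nth-< (length L₁) M (subst (length L₁ <_) (sym len) (length-<-++-∷ L₁ i L₂))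
  ...   | y , ey with nth⁻ (length L₁) M ey
  ...   | M₁ , M₂ , refl , lenM₁ = subAB-≢-[] i M₁ true M₂ (subst (λ z → subAB i (M₁ ++ z ∷ M₂) ≡ []) y≡1+i eM)
    where
    eM : subAB i (M₁ ++ y ∷ M₂) ≡ []
    eM = ++-conicalʳ (subAB i U′) _ (trans (sym (subAB-++ i U′ _)) e₁)
    y≡1+i : y ≡ suc i
    y≡1+i = ≤-antisym
      (Linked-≤-between M₁ y M₂ (suc i) N (subst (Linked _≤_) (++-assoc M₁ (y ∷ M₂) (suc i ∷ N)) sorted))
      (ColBelow-nth _ _ (length L₁) cb
        (trans (cong (nth (length L₁)) (++-assoc L₁ (i ∷ L₂) (i ∷ R))) (nth-length L₁ i (L₂ ++ i ∷ R)))
        (trans (cong (nth (length L₁)) (++-assoc M₁ (y ∷ M₂) (suc i ∷ N)))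
          (subst (λ k → nth k (M₁ ++ y ∷ M₂ ++ suc i ∷ N) ≡ just y) lenM₁ (nth-length M₁ y (M₂ ++ suc i ∷ N)))))

  -- Dually, lowering i+1 to i while the cell below holds i: the context is ∙ba, and its b can be
  -- neither right of the cell in its own row (the cell below it would be another a) nor in the row below.
  lower-below-upper : ∀ i R M N D′ L → subAB i ((R ++ M) ++ letter i false ∷ (N ++ D′)) ≡ true ∷ false ∷ [] →
    Linked _≤_ (M ++ i ∷ N) → ColBelow (M ++ i ∷ N) (L ++ suc i ∷ R) → length M ≡ length L → ⊥
  lower-below-upper i R M N D′ L e sorted cb len
    with a-in-ba _ _ (trans (sym (subAB-middle i (R ++ M) false (N ++ D′))) e)
  ... | e₁ , e₂ with ++-≡-[ true ]⁻ (subAB i R) (subAB i M) (trans (sym (subAB-++ i R M)) e₁)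
  ... | inj₂ (_ , eM) with subAB-split i M [] true [] eM
  ...   | M₁ , M₂ , refl , _ , _ =
    1+n≰n (Linked-≤-between M₁ (suc i) M₂ i N (subst (Linked _≤_) (++-assoc M₁ (suc i ∷ M₂) (i ∷ N)) sorted))
  lower-below-upper i R M N D′ L e sorted cb len | e₁ , e₂ | inj₁ (eR , _) with subAB-split i R [] true [] eR
  ...   | R₁ , R₂ , refl , _ , _ with ColBelow-nth-below _ _ (length L + suc (length R₁)) cb (nth-second L (suc i) (suc i) R₁ R₂)
  ...   | u , eu
    with nth⁻ (length R₁) N (trans (sym (subst (λ l → nth (l + suc (length R₁)) (M ++ i ∷ N) ≡ _) len
                                             (nth-++ʳ (suc (length R₁)) M (i ∷ N)))) eu)
  ...   | N₁ , N₂ , refl , _ = subAB-≢-[] i N₁ false N₂ (subst (λ z → subAB i (N₁ ++ z ∷ N₂) ≡ []) u≡i eN)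
    where
    eN : subAB i (N₁ ++ u ∷ N₂) ≡ []
    eN = ++-conicalˡ (subAB i (N₁ ++ u ∷ N₂)) _ (trans (sym (subAB-++ i (N₁ ++ u ∷ N₂) D′)) e₂)
    u≡i : u ≡ i
    u≡i = ≤-antisym (m<1+n⇒m≤n (ColBelow-nth _ _ _ cb eu (nth-second L (suc i) (suc i) R₁ R₂)))
                    (Linked-≤-between M i N₁ u N₂ sorted)

  raise-SemiStandard : ∀ i U L R D → SemiStandard (reverse D ++ (L ++ i ∷ R) ∷ reverse U) →
    SigmaContext (subAB i (concat U ++ L)) (subAB i (R ++ concat D)) →
    SemiStandard (reverse D ++ (L ++ suc i ∷ R) ∷ reverse U)
  raise-SemiStandard i U L R D ss ctx = SemiStandard-update B L i (suc i) R A ss h₁ h₂ h₃ h₄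
    where
    B = reverse D
    A = reverse U
    row : Linked _≤_ (L ++ i ∷ R)
    row = All-middle B _ A (proj₁ (proj₂ ss))
    h₁ : ∀ {y} → last L ≡ just y → y ≤ suc i
    h₁ e = ≤-trans (Linked-last L i R row e) (n≤1+n i)
    h₂ : ∀ {y} → head R ≡ just y → suc i ≤ y
    h₂ {y} e with head⁻ R e
    ... | R′ , refl = ≤∧≢⇒< (Linked-head L i R row e) i≢y
      where
      i≢y : i ≢ y
      i≢y refl = SigmaContext-¬a-first ctx _ (subAB-middle i [] false (R′ ++ concat D))
    h₃ : ∀ {z} → last B ≡ just z → ∀ {y} → nth (length L) z ≡ just y → y < suc i
    h₃ ez ey = ≤-trans (ColBelow-nth _ _ (length L) (Linked-last B _ A (proj₂ (proj₂ ss)) ez) ey (nth-length L i R))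
                       (n≤1+n i)
    h₄ : ∀ {z} → head A ≡ just z → ∀ {y} → nth (length L) z ≡ just y → suc i < y
    h₄ {z} ez {y} ey with above-in-prefix U L (length L) ez ey
    ... | U′ , M , N , eP , refl , len = ≤∧≢⇒< (ColBelow-nth _ _ (length L) cb (nth-length L i R) ey) 1+i≢y
      where
      cb : ColBelow (L ++ i ∷ R) z
      cb = Linked-head B _ A (proj₂ (proj₂ ss)) ez
      1+i≢y : suc i ≢ y
      1+i≢y refl = upper-above-lower i (concat U′) M N L R
        (trans (cong (subAB i) (sym eP))
          (SigmaContext-b-before ctx _ _ (trans (cong (subAB i) eP) (subAB-middle i (concat U′ ++ M) true (N ++ L)))))
        (All-head B _ A (proj₁ (proj₂ ss)) ez) cb len

  lower-SemiStandard : ∀ i U L R D → SemiStandard (reverse D ++ (L ++ suc i ∷ R) ∷ reverse U) →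
    SigmaContext (subAB i (concat U ++ L)) (subAB i (R ++ concat D)) →
    SemiStandard (reverse D ++ (L ++ i ∷ R) ∷ reverse U)
  lower-SemiStandard i U L R D ss ctx = SemiStandard-update B L (suc i) i R A ss h₁ h₂ h₃ h₄
    where
    B = reverse D
    A = reverse U
    row : Linked _≤_ (L ++ suc i ∷ R)
    row = All-middle B _ A (proj₁ (proj₂ ss))
    h₁ : ∀ {y} → last L ≡ just y → y ≤ i
    h₁ {y} e with last⁻ L e
    ... | L₀ , refl = m<1+n⇒m≤n (≤∧≢⇒< (Linked-last L (suc i) R row e) y≢1+i)
      where
      y≢1+i : y ≢ suc i
      y≢1+i refl = SigmaContext-¬b-last ctx (subAB i (concat U ++ L₀))
        (trans (cong (subAB i) (sym (++-assoc (concat U) L₀ [ suc i ]))) (subAB-middle i (concat U ++ L₀) true []))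
    h₂ : ∀ {y} → head R ≡ just y → i ≤ y
    h₂ e = <⇒≤ (Linked-head L (suc i) R row e)
    h₃ : ∀ {z} → last B ≡ just z → ∀ {y} → nth (length L) z ≡ just y → y < i
    h₃ {z} ez {y} ey with below-in-suffix R D (length L) ez ey
    ... | D′ , M , N , eS , refl , len = ≤∧≢⇒< (m<1+n⇒m≤n (ColBelow-nth _ _ (length L) cb ey (nth-length L (suc i) R))) y≢i
      where
      cb : ColBelow z (L ++ suc i ∷ R)
      cb = Linked-last B _ A (proj₂ (proj₂ ss)) ez
      y≢i : y ≢ i
      y≢i refl = lower-below-upper i R M N (concat D′) L
        (trans (cong (subAB i) (sym eS))
          (SigmaContext-a-after ctx _ _ (trans (cong (subAB i) eS) (subAB-middle i (R ++ M) false (N ++ concat D′)))))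
        (All-last B _ A (proj₁ (proj₂ ss)) ez) cb len
    h₄ : ∀ {z} → head A ≡ just z → ∀ {y} → nth (length L) z ≡ just y → i < y
    h₄ ez ey = <⇒≤ (ColBelow-nth _ _ (length L) (Linked-head B _ A (proj₂ (proj₂ ss)) ez) (nth-length L (suc i) R) ey)

  sigma-cell-SemiStandard : ∀ i c U L R D → SemiStandard (reverse D ++ (L ++ letter i c ∷ R) ∷ reverse U) →
    SigmaContext (subAB i (concat U ++ L)) (subAB i (R ++ concat D)) →
    SemiStandard (reverse D ++ (L ++ letter i (not c) ∷ R) ∷ reverse U)
  sigma-cell-SemiStandard i false = raise-SemiStandard i
  sigma-cell-SemiStandard i true  = lower-SemiStandard i

  sigma-SemiStandard : ∀ i t w′ → SemiStandard t → sigma i (rw t) ≡ just w′ →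
    Σ Tableau λ t′ → SemiStandard t′ × rw t′ ≡ w′ × shape t′ ≡ shape t
  sigma-SemiStandard i t w′ ss eq with sigma⁻ i (rw t) w′ eq
  ... | P , c , S , e , refl , ctx with rw-cell t P (letter i c) S e
  ... | U , L , R , D , refl , refl , refl =
    _ , sigma-cell-SemiStandard i c U L R D ss ctx , rw-middle U L (letter i (not c)) R D ,
    shape-middle (reverse D) L (letter i (not c)) (letter i c) R (reverse U)

module StandardTableaux where

  open Basics
  open Tableaux
  open Counting

  All-rw⇒All-rows : ∀ {P : ℕ → Set} t → All P (rw t) → All (All P) t
  All-rw⇒All-rows t a = All-resp-↭ (↭-reverse t) (All.concat⁻ a)

  Standard⇒degree : ∀ n t → Standard n t → degree t ≡ n
  Standard⇒degree n t (_ , c) = trans (↭-length c) (length-applyUpTo suc n)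

  Standard⇒positive : ∀ n t → Standard n t → All (1 ≤_) (rw t)
  Standard⇒positive n t (_ , c) = All-resp-↭ (↭-sym c) (All.map proj₁ (All-oneTo n))

  Standard⇒bounded : ∀ n t → Standard n t → All (All (_< suc n)) t
  Standard⇒bounded n t (_ , c) = All-rw⇒All-rows t (All-resp-↭ (↭-sym c) (All.map (s≤s ∘ proj₂) (All-oneTo n)))

  mult-rw : ∀ x t → mult x (rw t) ≡ mult x (concat t)
  mult-rw x []      = refl
  mult-rw x (r ∷ t) rewrite rw-∷ r t | mult-++ x (rw t) r | mult-++ x r (concat t) | mult-rw x t =
    +-comm (mult x (concat t)) (mult x r)

  mult-rows-≤1 : ∀ t → (∀ x → mult x (concat t) ≤ 1) → All (λ r → ∀ x → mult x r ≤ 1) t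
  mult-rows-≤1 []      h = []
  mult-rows-≤1 (r ∷ t) h =
    (λ x → m+n≤o⇒m≤o (mult x r) (subst (_≤ 1) (mult-++ x r (concat t)) (h x))) ∷
    mult-rows-≤1 t (λ x → m+n≤o⇒n≤o (mult x r) (subst (_≤ 1) (mult-++ x r (concat t)) (h x)))

  Linked-≤⇒< : ∀ r → Linked _≤_ r → (∀ x → mult x r ≤ 1) → Linked _<_ r
  Linked-≤⇒< []          l       h = []
  Linked-≤⇒< (x ∷ [])    l       h = [-]
  Linked-≤⇒< (x ∷ y ∷ r) (p ∷ l) h with x ℕ.≟ y
  ... | yes refl with subst (_≤ 1) (trans (mult-here x (x ∷ r)) (cong suc (mult-here x r))) (h x)
  ...   | s≤s ()
  Linked-≤⇒< (x ∷ y ∷ r) (p ∷ l) h | no x≢y =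
    ≤∧≢⇒< p x≢y ∷ Linked-≤⇒< (y ∷ r) l (λ z → ≤-trans (mult-∷-≤ z x (y ∷ r)) (h z))

  Standard⇒strict-rows : ∀ n t → Standard n t → All (Linked _<_) t
  Standard⇒strict-rows n t ((_ , rows , _) , c) = All.zipWith (λ (l , h) → Linked-≤⇒< _ l h) (rows , once)
    where
    once : All (λ r → ∀ x → mult x r ≤ 1) t
    once = mult-rows-≤1 t (λ x → subst (_≤ 1) (trans (sym (mult-↭ x c)) (mult-rw x t)) (mult-oneTo-≤1 x n))

module Strips where

  open Tableaux
  open Basics
  open Counting

  replicate-+ : ∀ k j (m : ℕ) → replicate (k + j) m ≡ replicate k m ++ replicate j m
  replicate-+ zero j m = refl
  replicate-+ (suc k) j m = cong (m ∷_) (replicate-+ k j m)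

  HStrip-↭ : ∀ {m b t t′ k} → HStrip m b t t′ k → rw t′ ↭ rw t ++ replicate k m
  HStrip-↭ stop = ↭-refl
  HStrip-↭ {m} (newTop {k = k} _ _) = ↭-reflexive (++-identityʳ (replicate k m))
  HStrip-↭ {m} (extend {k = k} {j} {r} {rs} {rs′} _ h) = begin
    rw ((r ++ replicate k m) ∷ rs′)  ≡⟨ rw-∷ _ rs′ ⟩
    rw rs′ ++ (r ++ replicate k m)   ↭⟨ ++⁺ʳ _ (HStrip-↭ h) ⟩
    (rw rs ++ replicate j m) ++ (r ++ replicate k m) ≡⟨ ++-assoc (rw rs) _ _ ⟩
    rw rs ++ (replicate j m ++ (r ++ replicate k m)) ↭⟨ ++⁺ˡ (rw rs) (++-comm (replicate j m) _) ⟩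
    rw rs ++ ((r ++ replicate k m) ++ replicate j m) ≡⟨ cong (rw rs ++_) (++-assoc r _ _) ⟩
    rw rs ++ (r ++ (replicate k m ++ replicate j m)) ≡⟨ sym (++-assoc (rw rs) r _) ⟩
    (rw rs ++ r) ++ (replicate k m ++ replicate j m) ≡⟨ cong₂ _++_ (sym (rw-∷ r rs)) (sym (replicate-+ k j m)) ⟩
    rw (r ∷ rs) ++ replicate (k + j) m ∎
    where open PermutationReasoning

  HStrip-filterᵇ : ∀ (f : ℕ → Bool) {m b t t′ k} → f m ≡ false → HStrip m b t t′ k →
    filterᵇ f (rw t′) ≡ filterᵇ f (rw t)
  HStrip-filterᵇ f e stop = refl
  HStrip-filterᵇ f {m} e (newTop {k = k} _ _) rewrite ++-identityʳ (replicate k m) =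
    filterᵇ-none f (replicate k m) (All.replicate⁺ k e)
  HStrip-filterᵇ f {m} e (extend {k = k} {j} {r} {rs} {rs′} _ h)
    rewrite rw-∷ (r ++ replicate k m) rs′ | rw-∷ r rs | filterᵇ-++ f (rw rs′) (r ++ replicate k m)
    | filterᵇ-++ f r (replicate k m) | filterᵇ-none f (replicate k m) (All.replicate⁺ k e)
    | ++-identityʳ (filterᵇ f r) | HStrip-filterᵇ f e h
    | filterᵇ-++ f (rw rs) r = refl


  ColBelow-replicate : ∀ {m} r k X → All (_< m) r → k ≤ length r → ColBelow (r ++ X) (replicate k m)
  ColBelow-replicate r zero X a p = tt
  ColBelow-replicate [] (suc k) X a ()
  ColBelow-replicate (x ∷ r) (suc k) X (a ∷ as) (s≤s p) = a , ColBelow-replicate r k X as p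

  ColBelow-++-replicate : ∀ {m} r s k X → ColBelow r s → length s + k ≤ length r → All (_< m) r →
    ColBelow (r ++ X) (s ++ replicate k m)
  ColBelow-++-replicate r [] k X c p a = ColBelow-replicate r k X a p
  ColBelow-++-replicate [] (y ∷ s) k X () p a
  ColBelow-++-replicate (x ∷ r) (y ∷ s) k X (q , c) (s≤s p) (_ ∷ a) = q , ColBelow-++-replicate r s k X c p a

  Linked-++-replicate : ∀ {m} r k → Linked _≤_ r → All (_< m) r → Linked _≤_ (r ++ replicate k m)
  Linked-++-replicate [] zero l a = []
  Linked-++-replicate [] (suc zero) l a = [-]
  Linked-++-replicate [] (suc (suc k)) l a = ≤-refl ∷ Linked-++-replicate [] (suc k) l a
  Linked-++-replicate (x ∷ []) zero l a = [-]
  Linked-++-replicate (x ∷ []) (suc k) l (p ∷ _) = <⇒≤ p ∷ Linked-++-replicate [] (suc k) [] []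
  Linked-++-replicate (x ∷ y ∷ r) k (q ∷ l) (_ ∷ a) = q ∷ Linked-++-replicate (y ∷ r) k l a

  NonEmpty-++ : ∀ (r X : List ℕ) → NonEmptyRow r → NonEmptyRow (r ++ X)
  NonEmpty-++ (x ∷ r) X p = s≤s z≤n

  NonEmpty-replicate : ∀ {m} k → 0 < k → NonEmptyRow (replicate k m)
  NonEmpty-replicate (suc k) p = s≤s z≤n

  Linked-replicate : ∀ {m} k → Linked _≤_ (replicate k m)
  Linked-replicate zero = []
  Linked-replicate (suc zero) = [-]
  Linked-replicate (suc (suc k)) = ≤-refl ∷ Linked-replicate (suc k)

  HStrip-SemiStandard-above : ∀ {m b t t′ k} → HStrip m b t t′ k → ∀ r → length r ≡ b → All (_< m) r →
    Linked ColBelow (r ∷ t) → SemiStandard t → All (All (_< m)) t →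
    ∀ X → Linked ColBelow ((r ++ X) ∷ t′) × All NonEmptyRow t′ × All (Linked _≤_) t′
  HStrip-SemiStandard-above stop r e a lc ss at X = [-] , [] , []
  HStrip-SemiStandard-above (newTop {k = k} p q) r refl a lc ss at X =
    (ColBelow-replicate r k X a q ∷ [-]) , (NonEmpty-replicate k p ∷ []) , (Linked-replicate k ∷ [])
  HStrip-SemiStandard-above {m} (extend {k = k} {r = r1} {rs} p h) r refl a (c ∷ lc) (ne1 ∷ ne , l1 ∷ ls , lc′) (a1 ∷ at) X
    with HStrip-SemiStandard-above h r1 refl a1 lc′ (ne , ls , Linked.tail lc′) at (replicate k m)
  ... | lc′′ , ne′′ , ls′′ =
    ColBelow-++-replicate r r1 k X c p a ∷ lc′′ , NonEmpty-++ r1 _ ne1 ∷ ne′′ , Linked-++-replicate r1 k l1 a1 ∷ ls′′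

  HStrip-SemiStandard : ∀ {m b t t′ k} → HStrip m b t t′ k → SemiStandard t → All (All (_< m)) t → SemiStandard t′
  HStrip-SemiStandard stop ss at = [] , [] , []
  HStrip-SemiStandard (newTop {k = k} p q) ss at = (NonEmpty-replicate k p ∷ []) , (Linked-replicate k ∷ []) , [-]
  HStrip-SemiStandard {m} (extend {k = k} {r = r} {rs} p h) (ne1 ∷ ne , l1 ∷ ls , lc) (a1 ∷ at)
    with HStrip-SemiStandard-above h r refl a1 lc (ne , ls , Linked.tail lc) at (replicate k m)
  ... | lc′ , ne′ , ls′ = (NonEmpty-++ r _ ne1 ∷ ne′) , (Linked-++-replicate r k l1 a1 ∷ ls′) , lc′


  Linked-≤-max⇒replicate : ∀ M r → Linked _≤_ (M ∷ r) → All (_≤ M) r → r ≡ replicate (length r) M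
  Linked-≤-max⇒replicate M [] l a = refl
  Linked-≤-max⇒replicate M (y ∷ r) (p ∷ l) (q ∷ a) with ≤-antisym q p
  ... | refl = cong (M ∷_) (Linked-≤-max⇒replicate M r l a)

  row-split-max : ∀ M r → Linked _≤_ r → All (_≤ M) r →
    Σ (List ℕ) λ r0 → Σ ℕ λ k → r ≡ r0 ++ replicate k M × All (_< M) r0
  row-split-max M [] l a = [] , 0 , refl , []
  row-split-max M (x ∷ r) l (p ∷ a) with m≤n⇒m<n∨m≡n p
  ... | inj₁ q with row-split-max M r (Linked.tail l) a
  ...   | r0 , k , e , a′ = x ∷ r0 , k , cong (x ∷_) e , q ∷ a′
  row-split-max M (x ∷ r) l (p ∷ a) | inj₂ refl = [] , suc (length r) , cong (x ∷_) (Linked-≤-max⇒replicate x r l a) , []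

  ColBelow-length-bound : ∀ M r0 k s → ColBelow (r0 ++ replicate k M) s → All (_≤ M) s → length s ≤ length r0
  ColBelow-length-bound M r0 k [] c a = z≤n
  ColBelow-length-bound M [] zero (y ∷ s) () a
  ColBelow-length-bound M [] (suc k) (y ∷ s) (p , c) (q ∷ a) = ⊥-elim (<-irrefl refl (<-≤-trans p q))
  ColBelow-length-bound M (x ∷ r0) k (y ∷ s) (p , c) (q ∷ a) = s≤s (ColBelow-length-bound M r0 k s c a)

  ColBelow-prefix : ∀ r0 X s0 Y → ColBelow (r0 ++ X) (s0 ++ Y) → length s0 ≤ length r0 → ColBelow r0 s0
  ColBelow-prefix r0 X [] Y c p = tt
  ColBelow-prefix [] X (y ∷ s0) Y c ()
  ColBelow-prefix (x ∷ r0) X (y ∷ s0) Y (q , c) (s≤s p) = q , ColBelow-prefix r0 X s0 Y c p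

  Linked-prefix : ∀ (r0 X : List ℕ) → Linked _≤_ (r0 ++ X) → Linked _≤_ r0
  Linked-prefix [] X l = []
  Linked-prefix (x ∷ []) X l = [-]
  Linked-prefix (x ∷ y ∷ r0) X (p ∷ l) = p ∷ Linked-prefix (y ∷ r0) X l

  mult-replicate : ∀ M k → mult M (replicate k M) ≡ k
  mult-replicate M zero = refl
  mult-replicate M (suc k) = trans (mult-here M (replicate k M)) (cong suc (mult-replicate M k))

  mult-< : ∀ M r0 → All (_< M) r0 → mult M r0 ≡ 0
  mult-< M [] a = refl
  mult-< M (x ∷ r0) (p ∷ a) = trans (mult-other M x r0 (≢⇒≡ᵇ-false x M (λ e → <-irrefl e p))) (mult-< M r0 a)

  mult-row : ∀ M r0 k → All (_< M) r0 → mult M (r0 ++ replicate k M) ≡ k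
  mult-row M r0 k a rewrite mult-++ M r0 (replicate k M) | mult-< M r0 a = mult-replicate M k

  length-row : ∀ (M : ℕ) r0 k → length (r0 ++ replicate k M) ≡ length r0 + k
  length-row M r0 k = trans (length-++ r0) (cong (length r0 +_) (length-replicate k))

  replicate-max-is-top : ∀ M k zs → Linked ColBelow (replicate k M ∷ zs) → All NonEmptyRow zs → All (All (_≤ M)) zs →
    zs ≡ []
  replicate-max-is-top M k [] l ne a = refl
  replicate-max-is-top M k ([] ∷ zs) l (() ∷ _) a
  replicate-max-is-top M k ((y ∷ s) ∷ zs) (c ∷ l) ne ((q ∷ _) ∷ _) = ⊥-elim (bad k c)
    where
    bad : ∀ k → ColBelow (replicate k M) (y ∷ s) → ⊥
    bad zero ()
    bad (suc k) (p , _) = <-irrefl refl (<-≤-trans p q)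

  -- The cells holding the largest letter M end their rows and, by column strictness, lie in distinct
  -- columns: they form a horizontal strip.
  HStrip-remove : ∀ M (zs : Tableau) (r0 : List ℕ) k →
    Linked ColBelow ((r0 ++ replicate k M) ∷ zs) → SemiStandard zs → All (All (_≤ M)) zs →
    Σ Tableau λ T → Σ ℕ λ j → HStrip M (length r0) T zs j × j ≡ mult M (concat zs) ×
      Linked ColBelow (r0 ∷ T) × All NonEmptyRow T × All (Linked _≤_) T × All (All (_< M)) T
  HStrip-remove M [] r0 k lc ss a = [] , 0 , stop , refl , [-] , [] , [] , []
  HStrip-remove M (s ∷ zs) r0 k (c ∷ lc) (ne1 ∷ ne , l1 ∷ ls , lc′) (a1 ∷ a) with row-split-max M s l1 a1
  ... | [] , k′ , refl , _ with replicate-max-is-top M k′ zs lc′ ne a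
  ...   | refl = [] , k′ , newTop (pos k′ ne1) (subst (_≤ length r0) (length-replicate k′) (ColBelow-length-bound M r0 k _ c a1)) ,
      sym (trans (cong (mult M) (++-identityʳ (replicate k′ M))) (mult-replicate M k′)) , [-] , [] , [] , []
    where
    pos : ∀ k′ → NonEmptyRow (replicate k′ M) → 0 < k′
    pos (suc k′) _ = s≤s z≤n
  HStrip-remove M (s ∷ zs) r0 k (c ∷ lc) (ne1 ∷ ne , l1 ∷ ls , lc′) (a1 ∷ a) | (x ∷ s0) , k′ , refl , as0
    with HStrip-remove M zs (x ∷ s0) k′ lc′ (ne , ls , Linked.tail lc′) a
  ... | T′ , j , h , ej , lcT , neT , lsT , aT =
    (x ∷ s0) ∷ T′ , k′ + j ,
    extend (subst (_≤ length r0) (length-row M (x ∷ s0) k′) lb) h ,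
    count≡ ,
    (ColBelow-prefix r0 _ (x ∷ s0) _ c
       (≤-trans (subst (length (x ∷ s0) ≤_) (sym (length-row M (x ∷ s0) k′)) (m≤m+n _ k′)) lb) ∷ lcT) ,
    (s≤s z≤n ∷ neT) , (Linked-prefix (x ∷ s0) _ l1 ∷ lsT) , (as0 ∷ aT)
    where
    lb : length ((x ∷ s0) ++ replicate k′ M) ≤ length r0
    lb = ColBelow-length-bound M r0 k _ c a1
    count≡ : k′ + j ≡ mult M (concat (((x ∷ s0) ++ replicate k′ M) ∷ zs))
    count≡ = sym (trans (mult-++ M ((x ∷ s0) ++ replicate k′ M) (concat zs)) (cong₂ _+_ (mult-row M (x ∷ s0) k′ as0) (sym ej)))

  HStrip-remove-top : ∀ M z → SemiStandard z → All (All (_≤ M)) z → mult M (concat z) ≡ 2 →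
    Σ Tableau λ T → HStrip M (bottomLength T + 2) T z 2 × SemiStandard T × All (All (_< M)) T
  HStrip-remove-top M [] ss a ()
  HStrip-remove-top M (r ∷ zs) (ne1 ∷ ne , l1 ∷ ls , lc) (a1 ∷ a) e with row-split-max M r l1 a1
  ... | [] , k , refl , _ with replicate-max-is-top M k zs lc ne a
  ...   | refl with trans (sym (trans (cong (mult M) (++-identityʳ (replicate k M))) (mult-replicate M k))) e
  ...     | refl = [] , newTop (s≤s z≤n) (s≤s (s≤s z≤n)) , ([] , [] , []) , []
  HStrip-remove-top M (r ∷ zs) (ne1 ∷ ne , l1 ∷ ls , lc) (a1 ∷ a) e | (x ∷ r0) , k , refl , ar0
    with HStrip-remove M zs (x ∷ r0) k lc (ne , ls , Linked.tail lc) a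
  ... | T′ , j , h , ej , lcT , neT , lsT , aT =
    ((x ∷ r0) ∷ T′) ,
    subst (HStrip M (length (x ∷ r0) + 2) ((x ∷ r0) ∷ T′) (((x ∷ r0) ++ replicate k M) ∷ zs)) kj
      (extend (+-monoʳ-≤ (length (x ∷ r0)) k≤2) h) ,
    ((s≤s z≤n ∷ neT) , (Linked-prefix (x ∷ r0) _ l1 ∷ lsT) , lcT) , (ar0 ∷ aT)
    where
    kj : k + j ≡ 2
    kj = trans (cong₂ _+_ (sym (mult-row M (x ∷ r0) k ar0)) ej) (trans (sym (mult-++ M ((x ∷ r0) ++ replicate k M) (concat zs))) e)
    k≤2 : k ≤ 2
    k≤2 = subst (k ≤_) kj (m≤m+n k j)

module Relabelling (f : ℕ → ℕ) (D : ℕ → Set)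
                   (mono : ∀ {x y} → D x → D y → x ≤ y → f x ≤ f y)
                   (smono : ∀ {x y} → D x → D y → x < y → f x < f y) where

  map-Linked : ∀ r → All D r → Linked _≤_ r → Linked _≤_ (map f r)
  map-Linked []          a             l       = []
  map-Linked (x ∷ [])    a             l       = [-]
  map-Linked (x ∷ y ∷ r) (dx ∷ dy ∷ a) (p ∷ l) = mono dx dy p ∷ map-Linked (y ∷ r) (dy ∷ a) l

  map-ColBelow : ∀ r s → All D r → All D s → ColBelow r s → ColBelow (map f r) (map f s)
  map-ColBelow r       []      ar        as        c       = tt
  map-ColBelow []      (y ∷ s) ar        as        ()
  map-ColBelow (x ∷ r) (y ∷ s) (dx ∷ ar) (dy ∷ as) (p , c) = smono dx dy p , map-ColBelow r s ar as c

  map-columns : ∀ t → All (All D) t → Linked ColBelow t → Linked ColBelow (map (map f) t)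
  map-columns []          a               l       = []
  map-columns (r ∷ [])    a               l       = [-]
  map-columns (r ∷ s ∷ t) (ar ∷ as ∷ a)   (c ∷ l) = map-ColBelow r s ar as c ∷ map-columns (s ∷ t) (as ∷ a) l

  map-nonEmpty : ∀ t → All NonEmptyRow t → All NonEmptyRow (map (map f) t)
  map-nonEmpty []            []       = []
  map-nonEmpty ((x ∷ r) ∷ t) (p ∷ ps) = s≤s z≤n ∷ map-nonEmpty t ps

  map-SemiStandard : ∀ t → All (All D) t → SemiStandard t → SemiStandard (map (map f) t)
  map-SemiStandard t a (ne , rows , cols) =
    map-nonEmpty t ne , All.map⁺ (All.zipWith (λ (dr , l) → map-Linked _ dr l) (a , rows)) , map-columns t a cols

module B0Forward where

  open Basics
  open Sigma
  open Tableaux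
  open Counting
  open SigmaSemiStandard
  open CellUpdate
  open StandardTableaux
  open Strips

  rw-map : ∀ (f : ℕ → ℕ) t → rw (map (map f) t) ≡ map f (rw t)
  rw-map f t = trans (cong concat (sym (reverse-map (map f) t))) (concat-map (reverse t))

  shape-map : ∀ (f : ℕ → ℕ) t → shape (map (map f) t) ≡ shape t
  shape-map f []      = refl
  shape-map f (r ∷ t) = cong₂ _∷_ (length-map f r) (shape-map f t)

  AddStrip2-↭ : ∀ m T z → rw T ↭ oneTo m → AddStrip2 (suc m) T z → rw z ↭ suc m ∷ oneTo (suc m)
  AddStrip2-↭ m T z c h = begin
    rw z                            ↭⟨ HStrip-↭ h ⟩
    rw T ++ suc m ∷ suc m ∷ []      ↭⟨ ++⁺ʳ _ c ⟩
    oneTo m ++ suc m ∷ suc m ∷ []   ↭⟨ shift (suc m) (oneTo m) [ suc m ] ⟩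
    suc m ∷ (oneTo m ++ [ suc m ])  ≡⟨ cong (suc m ∷_) (applyUpTo-∷ʳ suc m) ⟩
    suc m ∷ oneTo (suc m)           ∎
    where open PermutationReasoning

  -- σₙ, …, σ₁ in turn move the doubled letter from n+1 down to 1.
  sigmaChain-SemiStandard : ∀ n N t w′ → suc n ≤ N → SemiStandard t → rw t ↭ suc n ∷ oneTo N →
    sigmaChain n (rw t) ≡ just w′ →
    Σ Tableau λ t′ → SemiStandard t′ × rw t′ ≡ w′ × shape t′ ≡ shape t × w′ ↭ 1 ∷ oneTo N
  sigmaChain-SemiStandard zero    N t w′ p ss c refl = t , ss , refl , refl , c
  sigmaChain-SemiStandard (suc n) N t w′ p ss c eq with >>=-just⁻ (sigma (suc n) (rw t)) (sigmaChain n) eq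
  ... | w₀ , e₁ , e₂ with sigma-SemiStandard (suc n) t w₀ ss e₁
  ... | t₀ , ss₀ , rw₀ , sh₀ with sigmaChain-SemiStandard n N t₀ w′ (≤-trans (n≤1+n _) p) ss₀
         (subst (_↭ suc n ∷ oneTo N) (sym rw₀)
                (sigma-↭ (suc n) true (rw t) w₀ (oneTo N) e₁ c (trans (mult-↭ (suc n) c) once)))
         (subst (λ q → sigmaChain n q ≡ just w′) (sym rw₀) e₂)
    where
    once : mult (suc n) (suc (suc n) ∷ oneTo N) ≡ 1
    once = trans (mult-other (suc n) (suc (suc n)) (oneTo N) (1+n≡ᵇn (suc n)))
                 (mult-oneTo-∈ (suc n) N (s≤s z≤n) (≤-trans (n≤1+n _) p))
  ... | t′ , ss′ , rw′ , sh′ , c′ = t′ , ss′ , rw′ , trans sh′ sh₀ , c′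

  r11to01⇒replaceFirst1 : ∀ w w′ → r11to01 w ≡ just w′ → replaceFirst1 w ≡ w′
  r11to01⇒replaceFirst1 w w′ e with length (filterᵇ (_≡ᵇ 1) w) ≡ᵇ 2
  r11to01⇒replaceFirst1 w w′ refl | true = refl
  r11to01⇒replaceFirst1 w w′ ()   | false

  replaceFirst1-1 : ∀ x w → (x ≡ᵇ 1) ≡ true → replaceFirst1 (x ∷ w) ≡ 0 ∷ w
  replaceFirst1-1 x w e rewrite e = refl

  replaceFirst1-≢1 : ∀ x w → (x ≡ᵇ 1) ≡ false → replaceFirst1 (x ∷ w) ≡ x ∷ replaceFirst1 w
  replaceFirst1-≢1 x w e rewrite e = refl

  replaceFirst1-split : ∀ w → 0 < mult 1 w → Σ (List ℕ) λ P → Σ (List ℕ) λ S →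
    w ≡ P ++ 1 ∷ S × replaceFirst1 w ≡ P ++ 0 ∷ S × All (_≢ 1) P
  replaceFirst1-split (x ∷ w) p with true⊎false (x ≡ᵇ 1)
  ... | inj₁ e = [] , w , cong (_∷ w) (≡ᵇ-true⇒≡ e) , replaceFirst1-1 x w e , []
  ... | inj₂ e with replaceFirst1-split w (subst (0 <_) (mult-other 1 x w e) p)
  ...   | P , S , e₁ , e₂ , a =
    x ∷ P , S , cong (x ∷_) e₁ , trans (replaceFirst1-≢1 x w e) (cong (x ∷_) e₂) , ≡ᵇ-false⇒≢ e ∷ a

  r11to01-SemiStandard : ∀ N t w′ → SemiStandard t → rw t ↭ 1 ∷ oneTo N → r11to01 (rw t) ≡ just w′ →
    Σ Tableau λ t′ → SemiStandard t′ × rw t′ ≡ w′ × shape t′ ≡ shape t × w′ ↭ 0 ∷ oneTo N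
  r11to01-SemiStandard N t w′ ss c eq
    with replaceFirst1-split (rw t) (subst (0 <_) (sym (trans (mult-↭ 1 c) (mult-here 1 (oneTo N)))) (s≤s z≤n))
  ... | P , S , e₁ , e₂ , ≢1 with update-cell t P 1 S 0 ss e₁ (All.zipWith lower-≤ (≢1 , posP))
                                   (All.map (λ _ _ → z≤n) posS) (All.map (λ { (s≤s _) (s≤s ()) }) posS)
                                   (All.map (λ _ q → ≤-trans (s≤s z≤n) q) posP)
    where
    positive : All (1 ≤_) (P ++ 1 ∷ S)
    positive = subst (All _) e₁ (All-resp-↭ (↭-sym c) (s≤s z≤n ∷ All.map proj₁ (All-oneTo N)))
    posP = All.++⁻ˡ P positive
    posS = All.++⁻ʳ [ 1 ] (All.++⁻ʳ P positive)
    lower-≤ : ∀ {y} → y ≢ 1 × 1 ≤ y → y ≤ 1 → y ≤ 0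
    lower-≤ (y≢1 , p) q = ⊥-elim (y≢1 (≤-antisym q p))
  ... | t′ , ss′ , rw′ , sh′ = t′ , ss′ , trans rw′ w≡ , sh′ ,
    subst (_↭ 0 ∷ oneTo N) w≡ (↭-trans (shift 0 P S) (prep 0 (drop-mid P [] (subst (_↭ 1 ∷ oneTo N) e₁ c))))
    where
    w≡ : P ++ 0 ∷ S ≡ w′
    w≡ = trans (sym e₂) (r11to01⇒replaceFirst1 (rw t) w′ eq)

  map-suc-SemiStandard : ∀ N t → SemiStandard t → rw t ↭ 0 ∷ oneTo N →
    SemiStandard (map (map suc) t) × rw (map (map suc) t) ↭ oneTo (suc N)
  map-suc-SemiStandard N t ss c =
    Relabelling.map-SemiStandard suc (λ _ → ⊤) (λ _ _ → s≤s) (λ _ _ → s≤s) t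
      (All.tabulate (λ _ → All.tabulate (λ _ → tt))) ss ,
    subst (_↭ oneTo (suc N)) (sym (rw-map suc t))
      (subst (map suc (rw t) ↭_) (cong (1 ∷_) (map-applyUpTo suc suc N)) (↭-map⁺ suc c))

  B0-forward : ∀ m T z v → Standard m T → AddStrip2 (suc m) T z → post m z ≡ just v →
    Standard (suc (suc m)) v × Σ (List ℕ) λ w₁ → sigmaChain m (rw z) ≡ just w₁ × w₁ ↭ 1 ∷ oneTo (suc m) ×
      rw v ≡ map suc (replaceFirst1 w₁)
  B0-forward m T z v std@(ssT , cT) h eq
    with >>=-just⁻ ((sigmaChain m (rw z) >>= r11to01) >>= tau 1) (λ w → just (fill (shape z) w)) eq
  ... | w₃ , e₃ , e₄ with >>=-just⁻ (sigmaChain m (rw z) >>= r11to01) (tau 1) e₃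
  ... | w₂ , e₅ , refl with >>=-just⁻ (sigmaChain m (rw z)) r11to01 e₅
  ... | w₁ , e₇ , e₈ with sigmaChain-SemiStandard m (suc m) z w₁ ≤-refl
                           (HStrip-SemiStandard h ssT (Standard⇒bounded m T std)) (AddStrip2-↭ m T z cT h) e₇
  ... | t₁ , ss₁ , rw₁ , sh₁ , c₁
    with r11to01-SemiStandard (suc m) t₁ w₂ ss₁ (subst (_↭ 1 ∷ oneTo (suc m)) (sym rw₁) c₁)
                                        (subst (λ q → r11to01 q ≡ just w₂) (sym rw₁) e₈)
  ... | t₂ , ss₂ , rw₂ , sh₂ , c₂ with map-suc-SemiStandard (suc m) t₂ ss₂ (subst (_↭ 0 ∷ oneTo (suc m)) (sym rw₂) c₂)
  ... | ss₃ , c₃ = (subst SemiStandard t₃≡v ss₃ , subst (λ q → rw q ↭ oneTo (suc (suc m))) t₃≡v c₃) ,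
      w₁ , e₇ , c₁ ,
      trans (cong rw (sym t₃≡v)) (trans (rw-map suc t₂) (cong (map suc) (trans rw₂ (sym (r11to01⇒replaceFirst1 w₁ w₂ e₈)))))
    where
    t₃≡v : map (map suc) t₂ ≡ v
    t₃≡v = trans (sym (fill-rw-sameShape (map (map suc) t₂) (map (map suc) t₂) refl))
      (trans (cong₂ fill (trans (shape-map suc t₂) (trans sh₂ sh₁)) (trans (rw-map suc t₂) (cong (map suc) rw₂)))
             (Maybe.just-injective e₄))

module B0Backward where

  open Basics
  open Sigma
  open Tableaux
  open Counting
  open SigmaSemiStandard
  open CellUpdate
  open StandardTableaux
  open Strips
  open B0Forward

  sigmaChainInv-SemiStandard : ∀ n N t → suc n ≤ N → SemiStandard t → rw t ↭ 1 ∷ oneTo N →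
    Σ (List ℕ) λ w → sigmaChainInv n (rw t) ≡ just w ×
      Σ Tableau λ t′ → SemiStandard t′ × rw t′ ≡ w × shape t′ ≡ shape t × w ↭ suc n ∷ oneTo N
  sigmaChainInv-SemiStandard zero    N t p ss c = rw t , refl , t , ss , refl , refl , c
  sigmaChainInv-SemiStandard (suc n) N t p ss c with sigmaChainInv-SemiStandard n N t (≤-trans (n≤1+n _) p) ss c
  ... | w , e , t₀ , ss₀ , rw₀ , sh₀ , c₀ with sigma-defined (suc n) w twice once
    where
    twice : mult (suc n) w ≡ 2
    twice = trans (mult-↭ (suc n) c₀)
      (trans (mult-here (suc n) (oneTo N)) (cong suc (mult-oneTo-∈ (suc n) N (s≤s z≤n) (≤-trans (n≤1+n _) p))))
    once : mult (suc (suc n)) w ≡ 1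
    once = trans (mult-↭ (suc (suc n)) c₀)
      (trans (mult-other (suc (suc n)) (suc n) (oneTo N) (n≡ᵇ1+n (suc n))) (mult-oneTo-∈ (suc (suc n)) N (s≤s z≤n) p))
  ... | w′ , σw with sigma-SemiStandard (suc n) t₀ w′ ss₀ (subst (λ q → sigma (suc n) q ≡ just w′) (sym rw₀) σw)
  ... | t′ , ss′ , rw′ , sh′ = w′ , trans (cong (_>>= sigma (suc n)) e) σw , t′ , ss′ , rw′ , trans sh′ sh₀ ,
    sigma-↭ (suc n) false w w′ (oneTo N) σw c₀
      (trans (mult-↭ (suc (suc n)) c₀)
        (trans (mult-other (suc (suc n)) (suc n) (oneTo N) (n≡ᵇ1+n (suc n))) (mult-oneTo-∈ (suc (suc n)) N (s≤s z≤n) p)))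

  ↭-cancel-twice : ∀ xs ys (a : ℕ) → xs ++ a ∷ a ∷ [] ↭ ys ++ a ∷ a ∷ [] → xs ↭ ys
  ↭-cancel-twice xs ys a p =
    subst₂ _↭_ (++-identityʳ xs) (++-identityʳ ys) (drop-mid xs ys {[]} {[]} (drop-mid xs ys p))

  filterᵇ-≡-∷⁻ : ∀ (f : ℕ → Bool) w y ys → filterᵇ f w ≡ y ∷ ys →
    Σ (List ℕ) λ P → Σ (List ℕ) λ S → w ≡ P ++ y ∷ S × filterᵇ f P ≡ [] × filterᵇ f S ≡ ys
  filterᵇ-≡-∷⁻ f (x ∷ w) y ys e with true⊎false (f x)
  ... | inj₁ ex with ∷-injective (trans (sym (filterᵇ-accept f x w ex)) e)
  ...   | refl , e′ = [] , w , refl , refl , e′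
  filterᵇ-≡-∷⁻ f (x ∷ w) y ys e | inj₂ ex with filterᵇ-≡-∷⁻ f w y ys (trans (sym (filterᵇ-reject f x w ex)) e)
  ...   | P , S , e₁ , e₂ , e₃ = x ∷ P , S , cong (x ∷_) e₁ , trans (filterᵇ-reject f x P ex) e₂ , e₃

  filterᵇ-≡⇒All : ∀ (f : ℕ → Bool) (Q : ℕ → Set) w ys → filterᵇ f w ≡ ys → All Q ys → (∀ x → f x ≡ false → Q x) →
    All Q w
  filterᵇ-≡⇒All f Q []      ys e  a h = []
  filterᵇ-≡⇒All f Q (x ∷ w) ys e  a h with true⊎false (f x)
  ... | inj₁ ex with ys | trans (sym (filterᵇ-accept f x w ex)) e | a
  ...   | .(x ∷ _) | refl | q ∷ a′ = q ∷ filterᵇ-≡⇒All f Q w _ refl a′ h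
  filterᵇ-≡⇒All f Q (x ∷ w) ys e a h | inj₂ ex =
    h x ex ∷ filterᵇ-≡⇒All f Q w ys (trans (sym (filterᵇ-reject f x w ex)) e) a h

  below3-false⇒3≤ : ∀ x → below 3 x ≡ false → 3 ≤ x
  below3-false⇒3≤ (suc (suc (suc x))) e = s≤s (s≤s (s≤s z≤n))

  replaceFirst1-++ : ∀ P S → All (2 ≤_) P → replaceFirst1 (P ++ 1 ∷ S) ≡ P ++ 0 ∷ S
  replaceFirst1-++ []      S a       = refl
  replaceFirst1-++ (x ∷ P) S (p ∷ a) =
    trans (replaceFirst1-≢1 x (P ++ 1 ∷ S) (≢⇒≡ᵇ-false x 1 (λ { refl → 1+n≰n p }))) (cong (x ∷_) (replaceFirst1-++ P S a))

  replaceFirst1⇒r11to01 : ∀ w w′ → mult 1 w ≡ 2 → replaceFirst1 w ≡ w′ → r11to01 w ≡ just w′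
  replaceFirst1⇒r11to01 w w′ e₁ e₂ with length (filterᵇ (_≡ᵇ 1) w) ≡ᵇ 2 in e
  ... | true  = cong just e₂
  ... | false with trans (sym e) (subst (λ k → (k ≡ᵇ 2) ≡ true) (sym e₁) refl)
  ...   | ()

  map-suc-pred : ∀ w → All (1 ≤_) w → map suc (map pred w) ≡ w
  map-suc-pred []          a       = refl
  map-suc-pred (suc x ∷ w) (_ ∷ a) = cong (suc x ∷_) (map-suc-pred w a)

  -- t₁ is t₂ with its letter 0 back to 1: undo σ₁ ⋯ σₘ on t₁ and strip off the two letters m+1.
  B0-inverse-from-cell : ∀ m v P S (t₂ t₁ : Tableau) →
    rw t₂ ≡ P ++ 0 ∷ S → rw t₁ ≡ P ++ 1 ∷ S → shape t₁ ≡ shape t₂ → SemiStandard t₁ →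
    All (2 ≤_) P → rw t₂ ↭ 0 ∷ oneTo (suc m) → map suc (rw t₂) ≡ rw v → shape t₂ ≡ shape v →
    Σ Tableau λ T → Standard m T × Σ Tableau λ z → AddStrip2 (suc m) T z × post m z ≡ just v
  B0-inverse-from-cell m v P S t₂ t₁ rw₂ rw₁ sh₁ ss₁ P≥2 c₂ rw-v sh₂ =
    let w , e , z , ssz , rwz , shz , cz = sigmaChainInv-SemiStandard m (suc m) t₁ ≤-refl ss₁ c₁
        cz′ = subst (_↭ suc m ∷ oneTo (suc m)) (sym rwz) cz
        T , h , ssT , _ = HStrip-remove-top (suc m) z ssz
          (All-rw⇒All-rows z (All-resp-↭ (↭-sym cz′) (≤-refl ∷ All.map proj₂ (All-oneTo (suc m)))))
          (trans (sym (mult-rw (suc m) z))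
            (trans (mult-↭ (suc m) cz′) (trans (mult-here (suc m) (oneTo (suc m)))
              (cong suc (mult-oneTo-∈ (suc m) (suc m) (s≤s z≤n) ≤-refl)))))
        cT : rw T ↭ oneTo m
        cT = ↭-cancel-twice (rw T) (oneTo m) (suc m) (↭-trans (↭-sym (HStrip-↭ h)) (↭-trans cz′
               (subst (λ q → suc m ∷ q ↭ oneTo m ++ suc m ∷ suc m ∷ []) (applyUpTo-∷ʳ suc m)
                      (↭-sym (shift (suc m) (oneTo m) [ suc m ])))))
        chain : sigmaChain m (rw z) ≡ just (rw t₁)
        chain = sigmaChainInv⇒sigmaChain m (rw z) (rw t₁) (trans e (cong just (sym rwz)))
        r : r11to01 (rw t₁) ≡ just (rw t₂)
        r = replaceFirst1⇒r11to01 (rw t₁) (rw t₂)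
              (trans (mult-↭ 1 c₁)
                (trans (mult-here 1 (oneTo (suc m))) (cong suc (mult-oneTo-∈ 1 (suc m) (s≤s z≤n) (s≤s z≤n)))))
              (trans (cong replaceFirst1 rw₁) (trans (replaceFirst1-++ P S P≥2) (sym rw₂)))
    in T , (ssT , cT) , z , h , post≡ z chain r (trans shz (trans sh₁ sh₂))
    where
    c₁ : rw t₁ ↭ 1 ∷ oneTo (suc m)
    c₁ = subst (_↭ 1 ∷ oneTo (suc m)) (sym rw₁)
           (↭-trans (shift 1 P S) (prep 1 (drop-mid P [] (subst (_↭ 0 ∷ oneTo (suc m)) rw₂ c₂))))
    post≡ : ∀ z → sigmaChain m (rw z) ≡ just (rw t₁) → r11to01 (rw t₁) ≡ just (rw t₂) → shape z ≡ shape v →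
      post m z ≡ just v
    post≡ z chain r sh rewrite chain | r = cong just (trans (cong (fill (shape z)) rw-v) (fill-rw-sameShape z v sh))

  B0-inverse : ∀ m v → Standard (suc (suc m)) v → filterᵇ (below 3) (rw v) ≡ 1 ∷ 2 ∷ [] →
    Σ Tableau λ T → Standard m T × Σ Tableau λ z → AddStrip2 (suc m) T z × post m z ≡ just v
  B0-inverse m v std@(ssv , cv) low with filterᵇ-≡-∷⁻ (below 3) (rw v) 1 [ 2 ] low
  ... | P , S , rw-v , lowP , lowS =
    let t₁ , ss₁ , rw₁ , sh₁ = update-cell t₂ (map pred P) 0 (map pred S) 1 ss₂ rw₂ c₁ c₂ c₃ c₄
    in B0-inverse-from-cell m v (map pred P) (map pred S) t₂ t₁ rw₂ rw₁ sh₁ ss₁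
         (All.map⁺ (All.map (λ { (s≤s (s≤s (s≤s _))) → s≤s (s≤s z≤n) }) P≥3)) content₂ suc-pred (shape-map pred v)
    where
    positive = Standard⇒positive _ v std
    t₂ = map (map pred) v
    ss₂ : SemiStandard t₂
    ss₂ = Relabelling.map-SemiStandard pred (1 ≤_)
            (λ { (s≤s _) (s≤s _) (s≤s p) → p }) (λ { (s≤s _) (s≤s _) (s≤s p) → p })
            v (All-rw⇒All-rows v positive) ssv
    rw₂ : rw t₂ ≡ map pred P ++ 0 ∷ map pred S
    rw₂ = trans (rw-map pred v) (trans (cong (map pred) rw-v) (map-++ pred P (1 ∷ S)))
    P≥3 : All (3 ≤_) P
    P≥3 = filterᵇ-≡⇒All (below 3) _ P [] lowP [] below3-false⇒3≤
    S≥2 : All (2 ≤_) S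
    S≥2 = filterᵇ-≡⇒All (below 3) _ S [ 2 ] lowS (s≤s (s≤s z≤n) ∷ [])
            (λ x e → ≤-trans (n≤1+n 2) (below3-false⇒3≤ x e))
    c₁ : All (λ y → y ≤ 0 → y ≤ 1) (map pred P)
    c₁ = All.map⁺ (All.map (λ _ q → ≤-trans q z≤n) P≥3)
    c₂ : All (λ y → 0 ≤ y → 1 ≤ y) (map pred S)
    c₂ = All.map⁺ (All.map (λ { (s≤s (s≤s _)) _ → s≤s z≤n }) S≥2)
    c₃ : All (λ y → y < 0 → y < 1) (map pred S)
    c₃ = All.map⁺ (All.map (λ _ ()) S≥2)
    c₄ : All (λ y → 0 < y → 1 < y) (map pred P)
    c₄ = All.map⁺ (All.map (λ { (s≤s (s≤s (s≤s _))) _ → s≤s (s≤s z≤n) }) P≥3)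
    content₂ : rw t₂ ↭ 0 ∷ oneTo (suc m)
    content₂ = subst (_↭ 0 ∷ oneTo (suc m)) (sym (rw-map pred v))
      (subst (map pred (rw v) ↭_) (map-applyUpTo suc pred (suc (suc m))) (↭-map⁺ pred cv))
    suc-pred : map suc (rw t₂) ≡ rw v
    suc-pred = trans (cong (map suc) (rw-map pred v)) (map-suc-pred (rw v) positive)

module Transposition where

  open Basics
  open Tableaux
  open StandardTableaux using (Standard⇒strict-rows)

  AllEmpty : Tableau → Set
  AllEmpty = All (_≡ [])

  heads-AllEmpty : ∀ E → AllEmpty E → heads E ≡ []
  heads-AllEmpty []       []         = refl
  heads-AllEmpty ([] ∷ E) (refl ∷ e) = heads-AllEmpty E e

  heads-++-AllEmpty : ∀ X E → AllEmpty E → heads (X ++ E) ≡ heads X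
  heads-++-AllEmpty []            E e = heads-AllEmpty E e
  heads-++-AllEmpty ([] ∷ X)      E e = heads-++-AllEmpty X E e
  heads-++-AllEmpty ((x ∷ r) ∷ X) E e = cong (x ∷_) (heads-++-AllEmpty X E e)

  drop1-AllEmpty : ∀ E → AllEmpty E → AllEmpty (map (drop 1) E)
  drop1-AllEmpty []       []         = []
  drop1-AllEmpty ([] ∷ E) (refl ∷ e) = refl ∷ drop1-AllEmpty E e

  columns-AllEmpty : ∀ c E → AllEmpty E → columns c E ≡ replicate c []
  columns-AllEmpty zero    E e = refl
  columns-AllEmpty (suc c) E e = cong₂ _∷_ (heads-AllEmpty E e) (columns-AllEmpty c _ (drop1-AllEmpty E e))

  columns-++-AllEmpty : ∀ c X E → AllEmpty E → columns c (X ++ E) ≡ columns c X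
  columns-++-AllEmpty zero    X E e = refl
  columns-++-AllEmpty (suc c) X E e = cong₂ _∷_ (heads-++-AllEmpty X E e)
    (trans (cong (columns c) (map-++ (drop 1) X E)) (columns-++-AllEmpty c (map (drop 1) X) _ (drop1-AllEmpty E e)))

  columns-+ : ∀ a b t → columns (a + b) t ≡ columns a t ++ columns b (map (drop a) t)
  columns-+ zero    b t = cong (columns b) (sym (map-id t))
  columns-+ (suc a) b t = cong (heads t ∷_) (trans (columns-+ a b (map (drop 1) t))
    (cong (columns a (map (drop 1) t) ++_) (cong (columns b) (trans (sym (map-∘ t)) (map-cong (drop-drop 1 a) t)))))

  columns-beyond : ∀ a b t → All (λ r → length r ≤ a) t → columns b (map (drop a) t) ≡ replicate b []
  columns-beyond a b t short = columns-AllEmpty b _ (All.map⁺ (All.map (drop-all a _) short))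

  heads-columns : ∀ c r t → c ≤ length r → heads (columns c (r ∷ t)) ≡ take c r
  heads-columns zero    r       t p       = refl
  heads-columns (suc c) (x ∷ r) t (s≤s p) = cong (x ∷_) (heads-columns c r (map (drop 1) t) p)

  drop1-columns : ∀ c r t → c ≤ length r → map (drop 1) (columns c (r ∷ t)) ≡ columns c t
  drop1-columns zero    r       t p       = refl
  drop1-columns (suc c) (x ∷ r) t (s≤s p) = cong (heads t ∷_) (drop1-columns c r (map (drop 1) t) p)

  length-heads : ∀ t → All NonEmptyRow t → length (heads t) ≡ length t
  length-heads []            _       = refl
  length-heads ((x ∷ r) ∷ t) (_ ∷ a) = cong suc (length-heads t a)

  bottomLength-transpose : ∀ t → All NonEmptyRow t → bottomLength (transposeT t) ≡ length t
  bottomLength-transpose []            _       = refl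
  bottomLength-transpose ((x ∷ r) ∷ t) (_ ∷ a) = cong suc (length-heads t a)

  Shape : Tableau → Set
  Shape = Linked (λ r s → length s ≤ length r)

  Shape-bottom : ∀ r t → Shape (r ∷ t) → All (λ s → length s ≤ length r) (r ∷ t)
  Shape-bottom r []      d       = ≤-refl ∷ []
  Shape-bottom r (s ∷ t) (p ∷ d) = ≤-refl ∷ All.map (λ q → ≤-trans q p) (Shape-bottom s t d)

  Shape-above : ∀ r t → Shape (r ∷ t) → All (λ s → length s ≤ bottomLength t) t × bottomLength t ≤ length r
  Shape-above r []      d       = [] , z≤n
  Shape-above r (s ∷ t) (p ∷ d) = Shape-bottom s t d , p

  transpose-involutive : ∀ t → All NonEmptyRow t → Shape t → transposeT (transposeT t) ≡ t
  transpose-involutive []             _        _ = refl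
  transpose-involutive ((x ∷ r) ∷ t) (_ ∷ ne) d =
    cong₂ _∷_ (trans (heads-columns L (x ∷ r) t ≤-refl) (take-all L (x ∷ r) ≤-refl))
      (trans (cong₂ columns (length-heads t ne) (drop1-columns L (x ∷ r) t ≤-refl)) rest)
    where
    L = length (x ∷ r)
    L₁ = bottomLength t
    short : All (λ s → length s ≤ L₁) t
    short = proj₁ (Shape-above (x ∷ r) t d)
    L₁≤L : L₁ ≤ L
    L₁≤L = proj₂ (Shape-above (x ∷ r) t d)
    rest : columns (length t) (columns L t) ≡ t
    rest = begin
      columns (length t) (columns L t)
        ≡⟨ cong (columns (length t))
                (trans (cong (λ q → columns q t) (sym (m+[n∸m]≡n L₁≤L))) (columns-+ L₁ (L ∸ L₁) t)) ⟩
      columns (length t) (columns L₁ t ++ columns (L ∸ L₁) (map (drop L₁) t))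
        ≡⟨ cong (λ q → columns (length t) (columns L₁ t ++ q)) (columns-beyond L₁ (L ∸ L₁) t short) ⟩
      columns (length t) (columns L₁ t ++ replicate (L ∸ L₁) [])
        ≡⟨ columns-++-AllEmpty (length t) (columns L₁ t) _ (All.replicate⁺ (L ∸ L₁) refl) ⟩
      columns (length t) (columns L₁ t)
        ≡⟨ cong (λ q → columns q (columns L₁ t)) (sym (bottomLength-transpose t ne)) ⟩
      transposeT (transposeT t)
        ≡⟨ transpose-involutive t ne (Linked.tail d) ⟩
      t ∎
      where open ≡-Reasoning

  ColBelow-length : ∀ r s → ColBelow r s → length s ≤ length r
  ColBelow-length r       []      c       = z≤n
  ColBelow-length []      (y ∷ s) ()
  ColBelow-length (x ∷ r) (y ∷ s) (_ , c) = s≤s (ColBelow-length r s c)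

  SemiStandard⇒Shape : ∀ t → Linked ColBelow t → Shape t
  SemiStandard⇒Shape t = Linked.map (λ {r} {s} → ColBelow-length r s)

  heads-above-empty : ∀ t → Linked ColBelow ([] ∷ t) → heads t ≡ []
  heads-above-empty []            l       = refl
  heads-above-empty ([] ∷ t)      (_ ∷ l) = heads-above-empty t l
  heads-above-empty ((y ∷ s) ∷ t) (() ∷ l)

  heads-increasing : ∀ t → Linked ColBelow t → Linked _<_ (heads t)
  heads-increasing []                       l             = []
  heads-increasing ([] ∷ [])                l             = []
  heads-increasing ((x ∷ r) ∷ [])           l             = [-]
  heads-increasing ([] ∷ s ∷ t)             (c ∷ l)       = heads-increasing (s ∷ t) l
  heads-increasing ((x ∷ r) ∷ [] ∷ t)       (c ∷ l)       rewrite heads-above-empty t l = [-]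
  heads-increasing ((x ∷ r) ∷ (y ∷ s) ∷ t) ((p , _) ∷ l) = p ∷ heads-increasing ((y ∷ s) ∷ t) l

  ColBelow-drop1 : ∀ r s → ColBelow r s → ColBelow (drop 1 r) (drop 1 s)
  ColBelow-drop1 r       []      c       = tt
  ColBelow-drop1 []      (y ∷ s) ()
  ColBelow-drop1 (x ∷ r) (y ∷ s) (_ , c) = c

  columns-drop1 : ∀ t → Linked ColBelow t → Linked ColBelow (map (drop 1) t)
  columns-drop1 []          l       = []
  columns-drop1 (r ∷ [])    l       = [-]
  columns-drop1 (r ∷ s ∷ t) (c ∷ l) = ColBelow-drop1 r s c ∷ columns-drop1 (s ∷ t) l

  transpose-rows : ∀ c t → Linked ColBelow t → All (Linked _≤_) (columns c t)
  transpose-rows zero    t l = []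
  transpose-rows (suc c) t l = Linked.map <⇒≤ (heads-increasing t l) ∷ transpose-rows c (map (drop 1) t) (columns-drop1 t l)

  transpose-nonEmpty : ∀ c r t → c ≤ length r → All NonEmptyRow (columns c (r ∷ t))
  transpose-nonEmpty zero    r       t p       = []
  transpose-nonEmpty (suc c) (x ∷ r) t (s≤s p) = s≤s z≤n ∷ transpose-nonEmpty c r (map (drop 1) t) p

  Shape-drop1 : ∀ t → Shape t → Shape (map (drop 1) t)
  Shape-drop1 []          d       = []
  Shape-drop1 (r ∷ [])    d       = [-]
  Shape-drop1 (r ∷ s ∷ t) (p ∷ d) = shorter r s p ∷ Shape-drop1 (s ∷ t) d
    where
    shorter : ∀ (r s : List ℕ) → length s ≤ length r → length (drop 1 s) ≤ length (drop 1 r)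
    shorter r       []      p       = z≤n
    shorter []      (y ∷ s) ()
    shorter (x ∷ r) (y ∷ s) (s≤s p) = p

  strict-drop1 : ∀ t → All (Linked _<_) t → All (Linked _<_) (map (drop 1) t)
  strict-drop1 []            []       = []
  strict-drop1 ([] ∷ t)      (l ∷ ls) = [] ∷ strict-drop1 t ls
  strict-drop1 ((x ∷ r) ∷ t) (l ∷ ls) = Linked.tail l ∷ strict-drop1 t ls

  heads-drop1-short : ∀ t → All (λ r → length r ≤ 1) t → heads (map (drop 1) t) ≡ []
  heads-drop1-short []                _            = refl
  heads-drop1-short ([] ∷ t)          (_ ∷ a)      = heads-drop1-short t a
  heads-drop1-short ((x ∷ []) ∷ t)    (_ ∷ a)      = heads-drop1-short t a
  heads-drop1-short ((x ∷ y ∷ r) ∷ t) (s≤s () ∷ a)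

  heads-ColBelow : ∀ t → All (Linked _<_) t → Shape t → ColBelow (heads t) (heads (map (drop 1) t))
  heads-ColBelow []                _                d = tt
  heads-ColBelow ([] ∷ t)          _                d
    rewrite heads-drop1-short t (All.map (λ p → ≤-trans p z≤n) (All.tail (Shape-bottom [] t d))) = tt
  heads-ColBelow ((x ∷ []) ∷ t)    _                d
    rewrite heads-drop1-short t (All.tail (Shape-bottom (x ∷ []) t d)) = tt
  heads-ColBelow ((x ∷ y ∷ r) ∷ t) ((p ∷ _) ∷ ls)   d = p , heads-ColBelow t ls (Linked.tail d)

  transpose-columns : ∀ c t → All (Linked _<_) t → Shape t → Linked ColBelow (columns c t)
  transpose-columns zero          t s d = []
  transpose-columns (suc zero)    t s d = [-]
  transpose-columns (suc (suc c)) t s d =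
    heads-ColBelow t s d ∷ transpose-columns (suc c) (map (drop 1) t) (strict-drop1 t s) (Shape-drop1 t d)

  rw-↭-concat : ∀ X → rw X ↭ concat X
  rw-↭-concat []      = ↭-refl
  rw-↭-concat (r ∷ X) = begin
    rw (r ∷ X)      ≡⟨ rw-∷ r X ⟩
    rw X ++ r       ↭⟨ ++⁺ʳ r (rw-↭-concat X) ⟩
    concat X ++ r   ↭⟨ ++-comm (concat X) r ⟩
    r ++ concat X   ∎
    where open PermutationReasoning

  concat-↭-heads : ∀ t → concat t ↭ heads t ++ concat (map (drop 1) t)
  concat-↭-heads []            = ↭-refl
  concat-↭-heads ([] ∷ t)      = concat-↭-heads t
  concat-↭-heads ((x ∷ r) ∷ t) = prep x (begin
    r ++ concat t                              ↭⟨ ++⁺ˡ r (concat-↭-heads t) ⟩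
    r ++ (heads t ++ concat (map (drop 1) t))  ↭⟨ shifts r (heads t) ⟩
    heads t ++ (r ++ concat (map (drop 1) t))  ∎)
    where open PermutationReasoning

  concat-columns-↭ : ∀ c t → All (λ r → length r ≤ c) t → concat (columns c t) ↭ concat t
  concat-columns-↭ zero    t a = ↭-reflexive (sym (concat-empty t a))
    where
    concat-empty : ∀ (t : Tableau) → All (λ r → length r ≤ 0) t → concat t ≡ []
    concat-empty []       _       = refl
    concat-empty ([] ∷ t) (_ ∷ a) = concat-empty t a
  concat-columns-↭ (suc c) t a = begin
    heads t ++ concat (columns c (map (drop 1) t)) ↭⟨ ++⁺ˡ (heads t) (concat-columns-↭ c (map (drop 1) t) (shorter t a)) ⟩
    heads t ++ concat (map (drop 1) t)             ↭⟨ ↭-sym (concat-↭-heads t) ⟩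
    concat t                                       ∎
    where
    open PermutationReasoning
    shorter : ∀ t → All (λ r → length r ≤ suc c) t → All (λ r → length r ≤ c) (map (drop 1) t)
    shorter []            []           = []
    shorter ([] ∷ t)      (_ ∷ a)      = z≤n ∷ shorter t a
    shorter ((x ∷ r) ∷ t) (s≤s p ∷ a)  = p ∷ shorter t a

  transpose-Standard : ∀ n t → Standard n t → Standard n (transposeT t)
  transpose-Standard n []      std = std
  transpose-Standard n (r ∷ t) std@((ne , rows , cols) , c) =
    (transpose-nonEmpty (length r) r t ≤-refl , transpose-rows (length r) (r ∷ t) cols ,
     transpose-columns (length r) (r ∷ t) (Standard⇒strict-rows n _ std) (SemiStandard⇒Shape _ cols)) ,
    (begin
      rw (columns (length r) (r ∷ t))      ↭⟨ rw-↭-concat (columns (length r) (r ∷ t)) ⟩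
      concat (columns (length r) (r ∷ t))
        ↭⟨ concat-columns-↭ (length r) (r ∷ t) (Shape-bottom r t (SemiStandard⇒Shape _ cols)) ⟩
      concat (r ∷ t)                       ↭⟨ ↭-sym (rw-↭-concat (r ∷ t)) ⟩
      rw (r ∷ t)                           ↭⟨ c ⟩
      oneTo n                              ∎)
    where open PermutationReasoning

  transpose-involutive-Standard : ∀ n t → Standard n t → transposeT (transposeT t) ≡ t
  transpose-involutive-Standard n t ((ne , _ , cols) , _) = transpose-involutive t ne (SemiStandard⇒Shape t cols)

module Restriction where

  open Basics
  open Tableaux
  open Transposition

  keepBelow : ℕ → List ℕ → List ℕ
  keepBelow k = filterᵇ (below k)

  nonEmptyPrefix : Tableau → Tableau
  nonEmptyPrefix []            = []
  nonEmptyPrefix ([] ∷ t)      = []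
  nonEmptyPrefix ((x ∷ r) ∷ t) = (x ∷ r) ∷ nonEmptyPrefix t

  restrict : ℕ → Tableau → Tableau
  restrict k t = nonEmptyPrefix (map (keepBelow k) t)

  keepBelow-reject : ∀ k x r → Linked _≤_ (x ∷ r) → below k x ≡ false → keepBelow k (x ∷ r) ≡ []
  keepBelow-reject k x []      l       e = filterᵇ-reject (below k) x [] e
  keepBelow-reject k x (y ∷ r) (p ∷ l) e =
    trans (filterᵇ-reject (below k) x (y ∷ r) e) (keepBelow-reject k y r l (below-false-mono k p e))

  heads-keepBelow : ∀ k t → All (Linked _≤_) t → heads (map (keepBelow k) t) ≡ keepBelow k (heads t)
  heads-keepBelow k []            _       = refl
  heads-keepBelow k ([] ∷ t)      (_ ∷ a) = heads-keepBelow k t a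
  heads-keepBelow k ((x ∷ r) ∷ t) (l ∷ a) with true⊎false (below k x)
  ... | inj₁ e rewrite filterᵇ-accept (below k) x r e | filterᵇ-accept (below k) x (heads t) e =
    cong (x ∷_) (heads-keepBelow k t a)
  ... | inj₂ e rewrite keepBelow-reject k x r l e | filterᵇ-reject (below k) x (heads t) e = heads-keepBelow k t a

  drop1-keepBelow : ∀ k r → Linked _≤_ r → drop 1 (keepBelow k r) ≡ keepBelow k (drop 1 r)
  drop1-keepBelow k []          l = refl
  drop1-keepBelow k (x ∷ r)     l with true⊎false (below k x)
  ... | inj₁ e rewrite filterᵇ-accept (below k) x r e = refl
  drop1-keepBelow k (x ∷ [])    l       | inj₂ e rewrite keepBelow-reject k x [] l e = refl
  drop1-keepBelow k (x ∷ y ∷ r) (p ∷ l) | inj₂ e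
    rewrite keepBelow-reject k x (y ∷ r) (p ∷ l) e = sym (keepBelow-reject k y r l (below-false-mono k p e))

  columns-keepBelow : ∀ k c t → All (Linked _≤_) t → columns c (map (keepBelow k) t) ≡ map (keepBelow k) (columns c t)
  columns-keepBelow k zero    t a = refl
  columns-keepBelow k (suc c) t a = cong₂ _∷_ (heads-keepBelow k t a)
    (trans (cong (columns c) (trans (sym (map-∘ t))
             (trans (map-cong-local (All.map (λ {r} → drop1-keepBelow k r) a)) (map-∘ t))))
           (columns-keepBelow k c (map (drop 1) t) (All.map⁺ (All.map (Linked-drop1 _) a))))

  ColBelow-keepBelow : ∀ k r s → ColBelow r s → Linked _≤_ r → Linked _≤_ s → ColBelow (keepBelow k r) (keepBelow k s)
  ColBelow-keepBelow k r       []      c       lr ls = tt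
  ColBelow-keepBelow k []      (y ∷ s) ()      lr ls
  ColBelow-keepBelow k (x ∷ r) (y ∷ s) (p , c) lr ls with true⊎false (below k y) | true⊎false (below k x)
  ... | inj₂ e | _ rewrite keepBelow-reject k y s ls e = tt
  ... | inj₁ e | inj₂ e′ with trans (sym e) (below-false-mono k (<⇒≤ p) e′)
  ... | ()
  ColBelow-keepBelow k (x ∷ r) (y ∷ s) (p , c) lr ls | inj₁ e | inj₁ e′
    rewrite filterᵇ-accept (below k) y s e | filterᵇ-accept (below k) x r e′ =
    p , ColBelow-keepBelow k r s c (Linked-drop1 (x ∷ r) lr) (Linked-drop1 (y ∷ s) ls)

  columns-map-keepBelow : ∀ k t → Linked ColBelow t → All (Linked _≤_) t → Linked ColBelow (map (keepBelow k) t)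
  columns-map-keepBelow k []          l       a             = []
  columns-map-keepBelow k (r ∷ [])    l       a             = [-]
  columns-map-keepBelow k (r ∷ s ∷ t) (c ∷ l) (lr ∷ ls ∷ a) =
    ColBelow-keepBelow k r s c lr ls ∷ columns-map-keepBelow k (s ∷ t) l (ls ∷ a)

  nonEmptyPrefix-split : ∀ X → Linked ColBelow X → Σ Tableau λ E → X ≡ nonEmptyPrefix X ++ E × AllEmpty E
  nonEmptyPrefix-split []            l = [] , refl , []
  nonEmptyPrefix-split ([] ∷ X)      l = [] ∷ X , refl , refl ∷ above-empty X l
    where
    above-empty : ∀ X → Linked ColBelow ([] ∷ X) → AllEmpty X
    above-empty []            _        = []
    above-empty ([] ∷ X)      (_ ∷ l)  = refl ∷ above-empty X l
    above-empty ((y ∷ s) ∷ X) (() ∷ _)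
  nonEmptyPrefix-split ((x ∷ r) ∷ X) l =
    let E , e , eE = nonEmptyPrefix-split X (Linked.tail l) in E , cong ((x ∷ r) ∷_) e , eE

  rw-++-AllEmpty : ∀ X E → AllEmpty E → rw (X ++ E) ≡ rw X
  rw-++-AllEmpty X E eE rewrite reverse-++ X E | sym (concat-++ (reverse E) (reverse X)) =
    cong (_++ rw X) (concat-empty (reverse E) (All-resp-↭ (↭-sym (↭-reverse E)) eE))
    where
    concat-empty : ∀ E → AllEmpty E → concat E ≡ []
    concat-empty []       _          = refl
    concat-empty ([] ∷ E) (refl ∷ e) = concat-empty E e

  rw-restrict : ∀ k t → SemiStandard t → rw (restrict k t) ≡ keepBelow k (rw t)
  rw-restrict k t (ne , rows , cols) with nonEmptyPrefix-split (map (keepBelow k) t) (columns-map-keepBelow k t cols rows)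
  ... | E , e , eE = begin
    rw (restrict k t)                        ≡⟨ sym (rw-++-AllEmpty (restrict k t) E eE) ⟩
    rw (restrict k t ++ E)                   ≡⟨ cong rw (sym e) ⟩
    rw (map (keepBelow k) t)                 ≡⟨ cong concat (sym (reverse-map (keepBelow k) t)) ⟩
    concat (map (keepBelow k) (reverse t))   ≡⟨ sym (filterᵇ-concat (below k) (reverse t)) ⟩
    keepBelow k (rw t)                       ∎
    where open ≡-Reasoning

  nonEmptyPrefix-nonEmpty : ∀ X → All NonEmptyRow (nonEmptyPrefix X)
  nonEmptyPrefix-nonEmpty []            = []
  nonEmptyPrefix-nonEmpty ([] ∷ X)      = []
  nonEmptyPrefix-nonEmpty ((x ∷ r) ∷ X) = s≤s z≤n ∷ nonEmptyPrefix-nonEmpty X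

  nonEmptyPrefix-All : ∀ {P : List ℕ → Set} X → All P X → All P (nonEmptyPrefix X)
  nonEmptyPrefix-All []            _       = []
  nonEmptyPrefix-All ([] ∷ X)      _       = []
  nonEmptyPrefix-All ((x ∷ r) ∷ X) (p ∷ a) = p ∷ nonEmptyPrefix-All X a

  nonEmptyPrefix-columns : ∀ X → Linked ColBelow X → Linked ColBelow (nonEmptyPrefix X)
  nonEmptyPrefix-columns []                        l       = []
  nonEmptyPrefix-columns ([] ∷ X)                  l       = []
  nonEmptyPrefix-columns ((x ∷ r) ∷ [])            l       = [-]
  nonEmptyPrefix-columns ((x ∷ r) ∷ [] ∷ X)        (c ∷ l) = [-]
  nonEmptyPrefix-columns ((x ∷ r) ∷ (y ∷ s) ∷ X)   (c ∷ l) = c ∷ nonEmptyPrefix-columns ((y ∷ s) ∷ X) l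

  restrict-SemiStandard : ∀ k t → SemiStandard t → SemiStandard (restrict k t)
  restrict-SemiStandard k t (ne , rows , cols) =
    nonEmptyPrefix-nonEmpty _ ,
    nonEmptyPrefix-All _ (All.map⁺ (All.map (Linked.filter⁺ (T? ∘ below k) ≤-trans) rows)) ,
    nonEmptyPrefix-columns _ (columns-map-keepBelow k t cols rows)

  keepBelow-oneTo : ∀ j d → keepBelow (suc j) (oneTo (j + d)) ≡ oneTo j
  keepBelow-oneTo j zero rewrite +-identityʳ j =
    filterᵇ-all _ (oneTo j) (All.map (λ p → <⇒below (s≤s (proj₂ p))) (All-oneTo j))
  keepBelow-oneTo j (suc d) = begin
    keepBelow (suc j) (oneTo (j + suc d))
      ≡⟨ cong (keepBelow (suc j) ∘ oneTo) (+-suc j d) ⟩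
    keepBelow (suc j) (oneTo (suc (j + d)))
      ≡⟨ cong (keepBelow (suc j)) (sym (applyUpTo-∷ʳ suc (j + d))) ⟩
    keepBelow (suc j) (oneTo (j + d) ++ [ suc (j + d) ])
      ≡⟨ filterᵇ-++ (below (suc j)) (oneTo (j + d)) _ ⟩
    keepBelow (suc j) (oneTo (j + d)) ++ keepBelow (suc j) [ suc (j + d) ]
      ≡⟨ cong₂ _++_ (keepBelow-oneTo j d) (filterᵇ-reject (below (suc j)) (suc (j + d)) [] (beyond j d)) ⟩
    oneTo j ++ []
      ≡⟨ ++-identityʳ (oneTo j) ⟩
    oneTo j ∎
    where
    open ≡-Reasoning
    beyond : ∀ j d → below (suc j) (suc (j + d)) ≡ false
    beyond zero    d = refl
    beyond (suc j) d = beyond j d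

  restrict-Standard : ∀ j n t → Standard n t → j ≤ n → Standard j (restrict (suc j) t)
  restrict-Standard j n t (ss , c) j≤n = restrict-SemiStandard (suc j) t ss ,
    subst (_↭ oneTo j) (sym (rw-restrict (suc j) t ss))
      (subst (keepBelow (suc j) (rw t) ↭_)
             (trans (cong (keepBelow (suc j) ∘ oneTo) (sym (m+[n∸m]≡n j≤n))) (keepBelow-oneTo j (n ∸ j)))
             (filter-↭ _ c))

  keepBelow-prefix : ∀ k r → Linked _≤_ r →
    r ≡ keepBelow k r ++ drop (length (keepBelow k r)) r ×
    (∀ {y} → head (drop (length (keepBelow k r)) r) ≡ just y → below k y ≡ false) ×
    All (λ x → below k x ≡ true) (keepBelow k r)
  keepBelow-prefix k []      l = refl , (λ ()) , []
  keepBelow-prefix k (x ∷ r) l with true⊎false (below k x)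
  ... | inj₂ e rewrite keepBelow-reject k x r l e = refl , (λ { refl → e }) , []
  ... | inj₁ e rewrite filterᵇ-accept (below k) x r e =
    let e₁ , e₂ , a = keepBelow-prefix k r (Linked-drop1 (x ∷ r) l) in cong (x ∷_) e₁ , e₂ , e ∷ a

  columns-keepBelow-nonEmpty : ∀ k b r t → b ≤ length r → All (λ x → below k x ≡ true) (take b r) →
    All NonEmptyRow (map (keepBelow k) (columns b (r ∷ t)))
  columns-keepBelow-nonEmpty k zero    r       t p       a       = []
  columns-keepBelow-nonEmpty k (suc b) (x ∷ r) t (s≤s p) (e ∷ a) rewrite filterᵇ-accept (below k) x (heads t) e =
    s≤s z≤n ∷ columns-keepBelow-nonEmpty k b r (map (drop 1) t) p a

  nonEmptyPrefix-++ : ∀ A B → All NonEmptyRow A → nonEmptyPrefix (A ++ B) ≡ A ++ nonEmptyPrefix B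
  nonEmptyPrefix-++ []            B _       = refl
  nonEmptyPrefix-++ ((x ∷ r) ∷ A) B (_ ∷ a) = cong ((x ∷ r) ∷_) (nonEmptyPrefix-++ A B a)

  ColBelow-drop : ∀ b r s → ColBelow r s → ColBelow (drop b r) (drop b s)
  ColBelow-drop zero    r       s       c       = c
  ColBelow-drop (suc b) r       []      c       = tt
  ColBelow-drop (suc b) []      (y ∷ s) ()
  ColBelow-drop (suc b) (x ∷ r) (y ∷ s) (_ , c) = ColBelow-drop b r s c

  columns-drop : ∀ b t → Linked ColBelow t → Linked ColBelow (map (drop b) t)
  columns-drop b []          l       = []
  columns-drop b (r ∷ [])    l       = [-]
  columns-drop b (r ∷ s ∷ t) (c ∷ l) = ColBelow-drop b r s c ∷ columns-drop b (s ∷ t) l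

  restrict-columns-from : ∀ k c y s t → Linked ColBelow ((y ∷ s) ∷ t) → below k y ≡ false →
    nonEmptyPrefix (map (keepBelow k) (columns c ((y ∷ s) ∷ t))) ≡ []
  restrict-columns-from k zero    y s t l e = refl
  restrict-columns-from k (suc c) y s t l e
    rewrite keepBelow-reject k y (heads t) (Linked.map <⇒≤ (heads-increasing ((y ∷ s) ∷ t) l)) e = refl

  restrict-columns-beyond : ∀ k r t D → r ≡ keepBelow k r ++ D → D ≡ drop (length (keepBelow k r)) r →
    (∀ {y} → head D ≡ just y → below k y ≡ false) → Linked ColBelow (r ∷ t) →
    nonEmptyPrefix (map (keepBelow k) (columns (length r ∸ length (keepBelow k r))
                                               (map (drop (length (keepBelow k r))) (r ∷ t)))) ≡ []
  restrict-columns-beyond k r t [] r≡ _ _ _ rewrite cong length r≡ | length-++ (keepBelow k r) {[]}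
    | +-identityʳ (length (keepBelow k r)) | n∸n≡0 (length (keepBelow k r)) = refl
  restrict-columns-beyond k r t (y ∷ s) r≡ D≡ big cols rewrite sym D≡ =
    restrict-columns-from k (length r ∸ length (keepBelow k r)) y s (map (drop (length (keepBelow k r))) t)
      (subst (λ q → Linked ColBelow (q ∷ map (drop (length (keepBelow k r))) t)) (sym D≡)
             (columns-drop (length (keepBelow k r)) (r ∷ t) cols))
      (big refl)

  restrict-transpose : ∀ k n t → Standard n t → transposeT (restrict k t) ≡ restrict k (transposeT t)
  restrict-transpose k n []      std = refl
  restrict-transpose k n (r ∷ t) ((ne , rows@(sorted ∷ _) , cols) , c)
    with nonEmptyPrefix-split (map (keepBelow k) (r ∷ t)) (columns-map-keepBelow k (r ∷ t) cols rows)
       | keepBelow-prefix k r sorted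
  ... | E , e , eE | r≡ , big , small = begin
    transposeT (restrict k (r ∷ t))
      ≡⟨ cong (λ q → columns q (restrict k (r ∷ t))) (bottomLength-nonEmptyPrefix (keepBelow k r) (map (keepBelow k) t)) ⟩
    columns b (restrict k (r ∷ t))
      ≡⟨ sym (columns-++-AllEmpty b _ E eE) ⟩
    columns b (restrict k (r ∷ t) ++ E)
      ≡⟨ cong (columns b) (sym e) ⟩
    columns b (map (keepBelow k) (r ∷ t))
      ≡⟨ columns-keepBelow k b (r ∷ t) rows ⟩
    map (keepBelow k) (columns b (r ∷ t))
      ≡⟨ sym (++-identityʳ _) ⟩
    map (keepBelow k) (columns b (r ∷ t)) ++ []
      ≡⟨ cong (map (keepBelow k) (columns b (r ∷ t)) ++_)
              (sym (restrict-columns-beyond k r t (drop b r) r≡ refl big cols)) ⟩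
    map (keepBelow k) (columns b (r ∷ t)) ++ nonEmptyPrefix (map (keepBelow k) (columns (L ∸ b) (map (drop b) (r ∷ t))))
      ≡⟨ sym (nonEmptyPrefix-++ _ _ (columns-keepBelow-nonEmpty k b r t b≤L (subst (All _) (sym take≡) small))) ⟩
    nonEmptyPrefix (map (keepBelow k) (columns b (r ∷ t)) ++ map (keepBelow k) (columns (L ∸ b) (map (drop b) (r ∷ t))))
      ≡⟨ cong nonEmptyPrefix (sym (map-++ (keepBelow k) (columns b (r ∷ t)) _)) ⟩
    nonEmptyPrefix (map (keepBelow k) (columns b (r ∷ t) ++ columns (L ∸ b) (map (drop b) (r ∷ t))))
      ≡⟨ cong (nonEmptyPrefix ∘ map (keepBelow k))
              (sym (trans (cong (λ q → columns q (r ∷ t)) (sym (m+[n∸m]≡n b≤L))) (columns-+ b (L ∸ b) (r ∷ t)))) ⟩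
    restrict k (transposeT (r ∷ t)) ∎
    where
    open ≡-Reasoning
    b = length (keepBelow k r)
    L = length r
    bottomLength-nonEmptyPrefix : ∀ r Y → bottomLength (nonEmptyPrefix (r ∷ Y)) ≡ length r
    bottomLength-nonEmptyPrefix []      Y = refl
    bottomLength-nonEmptyPrefix (x ∷ r) Y = refl
    b≤L : b ≤ L
    b≤L = subst (b ≤_) (sym (trans (cong length r≡) (length-++ (keepBelow k r)))) (m≤m+n b _)
    take≡ : take b r ≡ keepBelow k r
    take≡ = trans (cong (take b) r≡) (take-length-++ (keepBelow k r) (drop b r))

-- A standard tableau is recovered from its reading word by cutting it into maximal increasing runs.
module Runs where

  open Basics
  open Tableaux
  open StandardTableaux using (Standard⇒strict-rows)

  consRun : ℕ → List (List ℕ) → List (List ℕ)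
  consRun x []             = [ [ x ] ]
  consRun x ([] ∷ rs)      = [ x ] ∷ [] ∷ rs
  consRun x ((y ∷ r) ∷ rs) = if x <ᵇ y then (x ∷ y ∷ r) ∷ rs else [ x ] ∷ (y ∷ r) ∷ rs

  runs : List ℕ → List (List ℕ)
  runs []      = []
  runs (x ∷ w) = consRun x (runs w)

  rowsOf : List ℕ → Tableau
  rowsOf w = reverse (runs w)

  lastOr : ℕ → List ℕ → ℕ
  lastOr d []      = d
  lastOr d (x ∷ r) = lastOr x r

  BreaksAfter : ℕ → List (List ℕ) → Set
  BreaksAfter x R = R ≡ [] ⊎ (Σ ℕ λ y → Σ (List ℕ) λ r → Σ (List (List ℕ)) λ rs → R ≡ (y ∷ r) ∷ rs × y ≤ x)

  runs-++-run : ∀ x s W → Linked _<_ (x ∷ s) → BreaksAfter (lastOr x s) (runs W) → runs ((x ∷ s) ++ W) ≡ (x ∷ s) ∷ runs W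
  runs-++-run x []       W l       (inj₁ e)                    rewrite e = refl
  runs-++-run x []       W l       (inj₂ (y , r , rs , e , p)) rewrite e | ≤⇒below-false p = refl
  runs-++-run x (x′ ∷ s) W (p ∷ l) brk rewrite runs-++-run x′ s W l brk | <⇒below p = refl

  lastOr-≥ : ∀ y r → Linked _≤_ (y ∷ r) → y ≤ lastOr y r
  lastOr-≥ y []      l       = ≤-refl
  lastOr-≥ y (z ∷ r) (p ∷ l) = ≤-trans p (lastOr-≥ z r l)

  bottomRow : Tableau → List ℕ
  bottomRow []      = []
  bottomRow (r ∷ _) = r

  BreaksAfter-above : ∀ x s t W → Linked ColBelow ((x ∷ s) ∷ t) → All (Linked _<_) t → Linked _<_ (x ∷ s) →
    BreaksAfter (lastOr x s) (runs W) →
    ∀ {x′ s′} → bottomRow t ≡ x′ ∷ s′ → BreaksAfter (lastOr x′ s′) (runs ((x ∷ s) ++ W))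
  BreaksAfter-above x s (_ ∷ _) W ((p , _) ∷ _) (l′ ∷ _) l brk {x′} {s′} refl rewrite runs-++-run x s W l brk =
    inj₂ (x , s , runs W , refl , ≤-trans (<⇒≤ p) (lastOr-≥ x′ s′ (Linked.map <⇒≤ l′)))

  runs-rw-++ : ∀ t W → All NonEmptyRow t → All (Linked _<_) t → Linked ColBelow t →
    (∀ {x s} → bottomRow t ≡ x ∷ s → BreaksAfter (lastOr x s) (runs W)) →
    runs (rw t ++ W) ≡ reverse t ++ runs W
  runs-rw-++ []            W ne       st       cols brk = refl
  runs-rw-++ ((x ∷ s) ∷ t) W (_ ∷ ne) (l ∷ st) cols brk = begin
    runs (rw ((x ∷ s) ∷ t) ++ W)           ≡⟨ cong (λ q → runs (q ++ W)) (rw-∷ (x ∷ s) t) ⟩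
    runs ((rw t ++ (x ∷ s)) ++ W)          ≡⟨ cong runs (++-assoc (rw t) (x ∷ s) W) ⟩
    runs (rw t ++ ((x ∷ s) ++ W))          ≡⟨ runs-rw-++ t ((x ∷ s) ++ W) ne st (Linked.tail cols)
                                                (BreaksAfter-above x s t W cols st l (brk refl)) ⟩
    reverse t ++ runs ((x ∷ s) ++ W)       ≡⟨ cong (reverse t ++_) (runs-++-run x s W l (brk refl)) ⟩
    reverse t ++ (x ∷ s) ∷ runs W          ≡⟨ sym (++-assoc (reverse t) [ x ∷ s ] (runs W)) ⟩
    (reverse t ++ [ x ∷ s ]) ++ runs W     ≡⟨ cong (_++ runs W) (sym (unfold-reverse (x ∷ s) t)) ⟩
    reverse ((x ∷ s) ∷ t) ++ runs W        ∎
    where open ≡-Reasoning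

  rowsOf-rw : ∀ n t → Standard n t → rowsOf (rw t) ≡ t
  rowsOf-rw n t std@((ne , _ , cols) , _) = begin
    reverse (runs (rw t))         ≡⟨ cong (reverse ∘ runs) (sym (++-identityʳ (rw t))) ⟩
    reverse (runs (rw t ++ []))   ≡⟨ cong reverse (runs-rw-++ t [] ne (Standard⇒strict-rows n t std) cols (λ _ → inj₁ refl)) ⟩
    reverse (reverse t ++ [])     ≡⟨ cong reverse (++-identityʳ (reverse t)) ⟩
    reverse (reverse t)           ≡⟨ reverse-involutive t ⟩
    t                             ∎
    where open ≡-Reasoning

module Permutations where

  insertions : ℕ → List ℕ → List (List ℕ)
  insertions x []       = [ [ x ] ]
  insertions x (y ∷ ys) = (x ∷ y ∷ ys) ∷ map (y ∷_) (insertions x ys)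

  permutations : List ℕ → List (List ℕ)
  permutations []       = [ [] ]
  permutations (x ∷ xs) = concatMap (insertions x) (permutations xs)

  ∈-insertions : ∀ x p₁ p₂ → p₁ ++ x ∷ p₂ ∈ insertions x (p₁ ++ p₂)
  ∈-insertions x []       []       = here refl
  ∈-insertions x []       (_ ∷ _)  = here refl
  ∈-insertions x (y ∷ p₁) p₂       = there (∈-map⁺ (y ∷_) (∈-insertions x p₁ p₂))

  ↭⇒∈-permutations : ∀ ys xs → xs ↭ ys → xs ∈ permutations ys
  ↭⇒∈-permutations []       xs p rewrite ↭-empty-inv p = here refl
  ↭⇒∈-permutations (y ∷ ys) xs p with ∈-∃++ (∈-resp-↭ (↭-sym p) (here refl))
  ... | p₁ , p₂ , refl = ∈-concat⁺′ (∈-insertions y p₁ p₂)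
    (∈-map⁺ (insertions y) (↭⇒∈-permutations ys (p₁ ++ p₂) (drop-mid p₁ [] p)))

module Decision where

  colBelow? : ∀ r s → Dec (ColBelow r s)
  colBelow? r       []      = yes tt
  colBelow? []      (_ ∷ _) = no λ ()
  colBelow? (x ∷ r) (y ∷ s) = x ℕ.<? y ×-dec colBelow? r s

  semiStandard? : ∀ t → Dec (SemiStandard t)
  semiStandard? t =
    all? (λ r → 0 ℕ.<? length r) t ×-dec all? (linked? ℕ._≤?_) t ×-dec linked? colBelow? t

module FourLetterWords where

  open Basics using (below)
  open Runs using (rowsOf)

  low : List ℕ → List ℕ
  low = filterᵇ (below 3)

  -- the {1,2}-subword of every term of B₂⁽ʸ⁾ applied to a standard tableau
  order : Bool → List ℕ
  order false = 1 ∷ 2 ∷ []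
  order true  = 2 ∷ 1 ∷ []

  zeroToOne : List ℕ → List ℕ
  zeroToOne = map (λ x → if x ≡ᵇ 0 then 1 else x)

  -- For a term v of B₂⁽⁰⁾u, the word sub1234 v determines the {1,2}-subword of u: undo τ₁ and
  -- r₍₁₁→₀₁₎, then σ₁ and σ₂; the letters 1, 2 are untouched by σ₃, …, σₙ and by the added strip.
  preimageLow : List ℕ → Maybe (List ℕ)
  preimageLow p = (sigma 1 (zeroToOne (map pred p)) >>= sigma 2) >>= λ q → just (low q)

  PatternB0 : Bool → List ℕ → Set
  PatternB0 y p = low p ≡ order false × preimageLow p ≡ just (order y)

  transposeWord : List ℕ → List ℕ
  transposeWord p = readingWord (transposeT (rowsOf p))

  view : Bool → List ℕ → List ℕ
  view false p = p
  view true  p = transposeWord p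

  table : Bool → Bool → List (List ℕ)
  table false false = (1 ∷ 2 ∷ 3 ∷ 4 ∷ []) ∷ (4 ∷ 1 ∷ 2 ∷ 3 ∷ []) ∷ (3 ∷ 4 ∷ 1 ∷ 2 ∷ []) ∷ []
  table false true  = (4 ∷ 3 ∷ 1 ∷ 2 ∷ []) ∷ (3 ∷ 1 ∷ 2 ∷ 4 ∷ []) ∷ []
  table true  false = (4 ∷ 2 ∷ 1 ∷ 3 ∷ []) ∷ (2 ∷ 1 ∷ 3 ∷ 4 ∷ []) ∷ []
  table true  true  = (4 ∷ 3 ∷ 2 ∷ 1 ∷ []) ∷ (3 ∷ 2 ∷ 1 ∷ 4 ∷ []) ∷ (2 ∷ 4 ∷ 1 ∷ 3 ∷ []) ∷ []

  patternB0? : ∀ y p → Dec (PatternB0 y p)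
  patternB0? y p = List.≡-dec ℕ._≟_ (low p) _ ×-dec Maybe.≡-dec (List.≡-dec ℕ._≟_) (preimageLow p) _

  Agrees : Bool → Bool → List ℕ → Set
  Agrees x y p = SemiStandard (rowsOf p) →
    (PatternB0 (x xor y) (view x p) → p ∈ table x y) × (p ∈ table x y → PatternB0 (x xor y) (view x p))

  agrees? : ∀ x y p → Dec (Agrees x y p)
  agrees? x y p = Decision.semiStandard? (rowsOf p) →-dec
    ((patternB0? (x xor y) (view x p) →-dec p ∈? table x y) ×-dec (p ∈? table x y →-dec patternB0? (x xor y) (view x p)))

  agrees-on-permutations : ∀ x y → All (Agrees x y) (Permutations.permutations (1 ∷ 2 ∷ 3 ∷ 4 ∷ []))
  agrees-on-permutations false false = toWitness {a? = all? (agrees? false false) _} tt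
  agrees-on-permutations false true  = toWitness {a? = all? (agrees? false true) _} tt
  agrees-on-permutations true  false = toWitness {a? = all? (agrees? true false) _} tt
  agrees-on-permutations true  true  = toWitness {a? = all? (agrees? true true) _} tt

  patternB0⇔table : ∀ x y p → p ∈ Permutations.permutations (1 ∷ 2 ∷ 3 ∷ 4 ∷ []) → SemiStandard (rowsOf p) →
    PatternB0 (x xor y) (view x p) ⇔ p ∈ table x y
  patternB0⇔table x y p p∈ ss = mk⇔ (proj₁ (All.lookup (agrees-on-permutations x y) p∈ ss))
                                   (proj₂ (All.lookup (agrees-on-permutations x y) p∈ ss))
module B0LowLetters where

  open Basics
  open Sigma
  open Tableaux using (rw)
  open Strips using (HStrip-filterᵇ)
  open B0Forward using (B0-forward; replaceFirst1-1; replaceFirst1-≢1)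
  open FourLetterWords

  in1to4 : ℕ → Bool
  in1to4 x = (0 <ᵇ x) ∧ (x <ᵇ 5)

  filterᵇ-replaceFirst1 : ∀ (f : ℕ → Bool) w → f 0 ≡ true → f 1 ≡ true →
    filterᵇ f (replaceFirst1 w) ≡ replaceFirst1 (filterᵇ f w)
  filterᵇ-replaceFirst1 f []      e₀ e₁ = refl
  filterᵇ-replaceFirst1 f (x ∷ w) e₀ e₁ with true⊎false (x ≡ᵇ 1)
  ... | inj₁ e rewrite replaceFirst1-1 x w e | ≡ᵇ-true⇒≡ {x} {1} e | filterᵇ-accept f 0 w e₀
    | filterᵇ-accept f 1 w e₁ = refl
  ... | inj₂ e rewrite replaceFirst1-≢1 x w e with true⊎false (f x)
  ...   | inj₁ ef rewrite filterᵇ-accept f x (replaceFirst1 w) ef | filterᵇ-accept f x w ef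
    | replaceFirst1-≢1 x (filterᵇ f w) e = cong (x ∷_) (filterᵇ-replaceFirst1 f w e₀ e₁)
  ...   | inj₂ ef rewrite filterᵇ-reject f x (replaceFirst1 w) ef | filterᵇ-reject f x w ef =
    filterᵇ-replaceFirst1 f w e₀ e₁

  zeroToOne-positive : ∀ w → All (1 ≤_) w → zeroToOne w ≡ w
  zeroToOne-positive []          _       = refl
  zeroToOne-positive (suc y ∷ w) (_ ∷ a) = cong (suc y ∷_) (zeroToOne-positive w a)

  zeroToOne-replaceFirst1 : ∀ w → All (1 ≤_) w → zeroToOne (replaceFirst1 w) ≡ w
  zeroToOne-replaceFirst1 []      _       = refl
  zeroToOne-replaceFirst1 (x ∷ w) (p ∷ a) with true⊎false (x ≡ᵇ 1)
  ... | inj₁ e rewrite replaceFirst1-1 x w e | ≡ᵇ-true⇒≡ {x} {1} e = cong (1 ∷_) (zeroToOne-positive w a)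
  ... | inj₂ e rewrite replaceFirst1-≢1 x w e with x | p
  ...   | suc y | _ = cong (suc y ∷_) (zeroToOne-replaceFirst1 w a)

  map-pred-suc : ∀ w → map pred (map suc w) ≡ w
  map-pred-suc w = trans (sym (map-∘ w)) (map-id w)

  below3⇒below4 : ∀ x → below 3 x ≡ true → below 4 x ≡ true
  below3⇒below4 0 _ = refl
  below3⇒below4 1 _ = refl
  below3⇒below4 2 _ = refl

  B0-low : ∀ m T z v → Standard m T → AddStrip2 (suc m) T z → post m z ≡ just v → low (rw v) ≡ order false
  B0-low m T z v std h e with B0-forward m T z v std h e
  ... | _ , w₁ , _ , w₁↭ , rw-v = begin
    low (rw v)                                    ≡⟨ cong low rw-v ⟩
    low (map suc (replaceFirst1 w₁))              ≡⟨ filterᵇ-map (below 3) suc (replaceFirst1 w₁) ⟩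
    map suc (filterᵇ (below 2) (replaceFirst1 w₁)) ≡⟨ cong (map suc) (filterᵇ-replaceFirst1 (below 2) w₁ refl refl) ⟩
    map suc (replaceFirst1 (filterᵇ (below 2) w₁)) ≡⟨ cong (map suc ∘ replaceFirst1) ones ⟩
    order false                                   ∎
    where
    open ≡-Reasoning
    ones↭ : filterᵇ (below 2) w₁ ↭ 1 ∷ 1 ∷ []
    ones↭ = subst (filterᵇ (below 2) w₁ ↭_)
      (cong (λ q → 1 ∷ 1 ∷ q) (filterᵇ-none (below 2) _ (All.applyUpTo⁺₂ (suc ∘ suc) m (λ _ → refl))))
      (filter-↭ _ w₁↭)
    two-ones : ∀ (xs : List ℕ) → length xs ≡ 2 → All (_≡ 1) xs → xs ≡ 1 ∷ 1 ∷ []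
    two-ones (_ ∷ _ ∷ []) _ (refl ∷ refl ∷ []) = refl
    ones : filterᵇ (below 2) w₁ ≡ 1 ∷ 1 ∷ []
    ones = two-ones _ (↭-length ones↭) (All-resp-↭ (↭-sym ones↭) (refl ∷ refl ∷ []))

  preimageLow-B0 : ∀ k u z v → Standard (suc (suc k)) u → AddStrip2 (suc (suc (suc k))) u z →
    post (suc (suc k)) z ≡ just v → preimageLow (sub1234 v) ≡ just (low (rw u))
  preimageLow-B0 k u z v std h e with B0-forward (suc (suc k)) u z v std h e
  ... | _ , w₁ , chain , w₁↭ , rw-v with sigmaChain-split₂ k (rw z) w₁ chain
  ... | w′ , low-w′ , chain₂ with >>=-just⁻ (sigma 2 w′) (sigmaChain 1) chain₂
  ... | w″ , σ₂ , chain₁ with >>=-just⁻ (sigma 1 w″) (sigmaChain 0) chain₁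
  ... | _ , σ₁ , refl = begin
    preimageLow (sub1234 v)
      ≡⟨ cong preimageLow sub1234-v ⟩
    preimageLow (map suc (replaceFirst1 (filterᵇ (below 4) w₁)))
      ≡⟨ cong (undo ∘ zeroToOne) (map-pred-suc (replaceFirst1 (filterᵇ (below 4) w₁))) ⟩
    undo (zeroToOne (replaceFirst1 (filterᵇ (below 4) w₁)))
      ≡⟨ cong undo (zeroToOne-replaceFirst1 _ (All.filter⁺ _ positive)) ⟩
    undo (filterᵇ (below 4) w₁)
      ≡⟨ cong (λ q → (q >>= sigma 2) >>= just ∘ low)
              (sigma-filterᵇ (below 4) 1 w₁ w″ refl refl (sigma-involutive 1 w″ w₁ σ₁)) ⟩
    (sigma 2 (filterᵇ (below 4) w″) >>= just ∘ low)
      ≡⟨ cong (_>>= just ∘ low) (sigma-filterᵇ (below 4) 2 w″ w′ refl refl (sigma-involutive 2 w′ w″ σ₂)) ⟩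
    just (low (filterᵇ (below 4) w′))
      ≡⟨ cong just (filterᵇ-filterᵇ (below 3) (below 4) w′ (All.tabulate λ {x} _ → below3⇒below4 x)) ⟩
    just (low w′)
      ≡⟨ cong just (trans low-w′ (HStrip-filterᵇ (below 3) refl h)) ⟩
    just (low (rw u)) ∎
    where
    open ≡-Reasoning
    undo : List ℕ → Maybe (List ℕ)
    undo q = (sigma 1 q >>= sigma 2) >>= just ∘ low
    positive : All (1 ≤_) w₁
    positive = All-resp-↭ (↭-sym w₁↭) (s≤s z≤n ∷ All.map proj₁ (All-oneTo _))
    sub1234-v : sub1234 v ≡ map suc (replaceFirst1 (filterᵇ (below 4) w₁))
    sub1234-v = trans (cong (filterᵇ in1to4) rw-v)
      (trans (filterᵇ-map in1to4 suc (replaceFirst1 w₁)) (cong (map suc) (filterᵇ-replaceFirst1 (below 4) w₁ refl refl)))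
module SmallLetters where

  open Basics
  open StandardTableaux using (Standard⇒positive)
  open Tableaux using (rw)
  open Transposition using (transpose-Standard)
  open Restriction using (restrict; rw-restrict; restrict-Standard; restrict-transpose)
  open Runs using (rowsOf; rowsOf-rw)
  open Permutations using (permutations; ↭⇒∈-permutations)
  open FourLetterWords using (low; order; transposeWord)
  open B0LowLetters using (in1to4)

  sub1234-restriction : ∀ n t → Standard n t → sub1234 t ≡ rw (restrict 5 t)
  sub1234-restriction n t std = trans
    (filterᵇ-cong in1to4 (below 5) (rw t) (All.map (λ { (s≤s _) → refl }) (Standard⇒positive n t std)))
    (sym (rw-restrict 5 t (proj₁ std)))

  low-sub1234 : ∀ n t → Standard n t → low (sub1234 t) ≡ low (rw t)
  low-sub1234 n t std = filterᵇ-filterᵇ (below 3) in1to4 (rw t)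
    (All.map (λ { {1} _ _ → refl ; {2} _ _ → refl ; {suc (suc (suc _))} _ () }) (Standard⇒positive n t std))

  sub1234-standard : ∀ n t → Standard n t → 4 ≤ n → Standard 4 (rowsOf (sub1234 t))
  sub1234-standard n t std 4≤n
    rewrite sub1234-restriction n t std | rowsOf-rw 4 (restrict 5 t) (restrict-Standard 4 n t std 4≤n) =
    restrict-Standard 4 n t std 4≤n

  sub1234-permutation : ∀ n t → Standard n t → 4 ≤ n → sub1234 t ∈ permutations (1 ∷ 2 ∷ 3 ∷ 4 ∷ [])
  sub1234-permutation n t std 4≤n rewrite sub1234-restriction n t std =
    ↭⇒∈-permutations _ _ (proj₂ (restrict-Standard 4 n t std 4≤n))

  rw-restrict-transpose : ∀ j n t → Standard n t → j ≤ n →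
    rw (restrict (suc j) (transposeT t)) ≡ transposeWord (rw (restrict (suc j) t))
  rw-restrict-transpose j n t std j≤n = begin
    rw (restrict (suc j) (transposeT t))  ≡⟨ cong rw (sym (restrict-transpose (suc j) n t std)) ⟩
    rw (transposeT (restrict (suc j) t))  ≡⟨ cong (rw ∘ transposeT) (sym (rowsOf-rw j _ (restrict-Standard j n t std j≤n))) ⟩
    transposeWord (rw (restrict (suc j) t)) ∎
    where open ≡-Reasoning

  sub1234-transpose : ∀ n t → Standard n t → 4 ≤ n → sub1234 (transposeT t) ≡ transposeWord (sub1234 t)
  sub1234-transpose n t std 4≤n = begin
    sub1234 (transposeT t)             ≡⟨ sub1234-restriction n _ (transpose-Standard n t std) ⟩
    rw (restrict 5 (transposeT t))     ≡⟨ rw-restrict-transpose 4 n t std 4≤n ⟩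
    transposeWord (rw (restrict 5 t))  ≡⟨ cong transposeWord (sym (sub1234-restriction n t std)) ⟩
    transposeWord (sub1234 t)          ∎
    where open ≡-Reasoning

  low-transpose : ∀ n t → Standard n t → 2 ≤ n → low (rw (transposeT t)) ≡ transposeWord (low (rw t))
  low-transpose n t std 2≤n = begin
    low (rw (transposeT t))            ≡⟨ sym (rw-restrict 3 _ (proj₁ (transpose-Standard n t std))) ⟩
    rw (restrict 3 (transposeT t))     ≡⟨ rw-restrict-transpose 2 n t std 2≤n ⟩
    transposeWord (rw (restrict 3 t))  ≡⟨ cong transposeWord (rw-restrict 3 t (proj₁ std)) ⟩
    transposeWord (low (rw t))         ∎
    where open ≡-Reasoning

  transposeWord-order : ∀ y → transposeWord (order y) ≡ order (not y)
  transposeWord-order false = refl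
  transposeWord-order true  = refl

  low-transpose-order : ∀ n t y → Standard n t → 2 ≤ n → low (rw t) ≡ order y →
    low (rw (transposeT t)) ≡ order (not y)
  low-transpose-order n t y std 2≤n e =
    trans (low-transpose n t std 2≤n) (trans (cong transposeWord e) (transposeWord-order y))

module Occurrence where

  open Basics
  open StandardTableaux using (Standard⇒degree)
  open Tableaux using (rw)
  open B0Forward using (B0-forward)
  open B0Backward using (B0-inverse)
  open Transposition using (transpose-Standard; transpose-involutive-Standard)
  open FourLetterWords
  open B0LowLetters using (B0-low; preimageLow-B0)
  open SmallLetters

  OccB0-intro : ∀ m T v z → Standard m T → AddStrip2 (suc m) T z → post m z ≡ just v → OccB0 T v
  OccB0-intro m T v z std h e rewrite Standard⇒degree m T std = z , h , e

  OccB0-elim : ∀ m T v → Standard m T → OccB0 T v → Σ Tableau λ z → AddStrip2 (suc m) T z × post m z ≡ just v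
  OccB0-elim m T v std o rewrite sym (Standard⇒degree m T std) = o

  B0-image : ∀ m T v → Standard m T → OccB0 T v → Standard (suc (suc m)) v × low (rw v) ≡ order false
  B0-image m T v std o =
    let z , h , e = OccB0-elim m T v std o in proj₁ (B0-forward m T z v std h e) , B0-low m T z v std h e

  B0-preimage : ∀ m v → Standard (suc (suc m)) v → low (rw v) ≡ order false →
    Σ Tableau λ T → Standard m T × OccB0 T v
  B0-preimage m v std e =
    let T , stdT , z , h , p = B0-inverse m v std e in T , stdT , OccB0-intro m T v z stdT h p

  OccB-image : ∀ k y T u → Standard k T → OccB y T u → Standard (suc (suc k)) u × low (rw u) ≡ order y
  OccB-image k false T u std o = B0-image k T u std o
  OccB-image k true  T _ std (u₀ , o , refl) =
    let std₀ , low₀ = B0-image k _ u₀ (transpose-Standard k T std) o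
    in transpose-Standard _ u₀ std₀ , low-transpose-order _ u₀ false std₀ (s≤s (s≤s z≤n)) low₀

  OccB-preimage : ∀ k y u → Standard (suc (suc k)) u → low (rw u) ≡ order y →
    Σ Tableau λ T → Standard k T × OccB y T u
  OccB-preimage k false u std e = B0-preimage k u std e
  OccB-preimage k true  u std e =
    let T₀ , std₀ , o = B0-preimage k (transposeT u) (transpose-Standard _ u std)
                          (low-transpose-order _ u true std (s≤s (s≤s z≤n)) e)
    in transposeT T₀ , transpose-Standard k T₀ std₀ ,
       transposeT u , subst (λ q → OccB0 q (transposeT u)) (sym (transpose-involutive-Standard k T₀ std₀)) o ,
       sym (transpose-involutive-Standard _ u std)

  OccBBΣ-B0⇔pattern : ∀ k y T′ → Standard (4 + k) T′ → OccBBΣ false y k T′ ⇔ PatternB0 y (sub1234 T′)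
  OccBBΣ-B0⇔pattern k y T′ std′ = mk⇔ to from
    where
    to : OccBBΣ false y k T′ → PatternB0 y (sub1234 T′)
    to (T , std , u , o , o′) =
      let stdᵤ , lowᵤ = OccB-image k y T u std o
          z , h , e = OccB0-elim _ u T′ stdᵤ o′
      in trans (low-sub1234 _ T′ std′) (B0-low _ u z T′ stdᵤ h e) ,
         trans (preimageLow-B0 k u z T′ stdᵤ h e) (cong just lowᵤ)
    from : PatternB0 y (sub1234 T′) → OccBBΣ false y k T′
    from (low′ , pre′) =
      let u , stdᵤ , o′ = B0-preimage _ T′ std′ (trans (sym (low-sub1234 _ T′ std′)) low′)
          z , h , e = OccB0-elim _ u T′ stdᵤ o′
          T , std , o = OccB-preimage k y u stdᵤ
                          (Maybe.just-injective (trans (sym (preimageLow-B0 k u z T′ stdᵤ h e)) pre′))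
      in T , std , u , o , o′

  OccBBΣ-B1⇔B0-transpose : ∀ k y T′ → Standard (4 + k) T′ →
    OccBBΣ true y k T′ ⇔ OccBBΣ false (not y) k (transposeT T′)
  OccBBΣ-B1⇔B0-transpose k y T′ std′ = mk⇔ to from
    where
    to : OccBBΣ true y k T′ → OccBBΣ false (not y) k (transposeT T′)
    to (T , std , u , o , v , o′ , refl) =
      let stdᵤ , lowᵤ = OccB-image k y T u std o
          T₂ , std₂ , o₂ = OccB-preimage k (not y) (transposeT u) (transpose-Standard _ u stdᵤ)
                             (low-transpose-order _ u y stdᵤ (s≤s (s≤s z≤n)) lowᵤ)
          stdᵥ = proj₁ (B0-image _ _ v (transpose-Standard _ u stdᵤ) o′)
      in T₂ , std₂ , transposeT u , o₂ , subst (OccB0 (transposeT u)) (sym (transpose-involutive-Standard _ v stdᵥ)) o′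
    from : OccBBΣ false (not y) k (transposeT T′) → OccBBΣ true y k T′
    from (T₂ , std₂ , u₂ , o₂ , o₂′) =
      let std₂ᵤ , low₂ᵤ = OccB-image k (not y) T₂ u₂ std₂ o₂
          T , std , o = OccB-preimage k y (transposeT u₂) (transpose-Standard _ u₂ std₂ᵤ)
                          (trans (low-transpose-order _ u₂ (not y) std₂ᵤ (s≤s (s≤s z≤n)) low₂ᵤ)
                                 (cong order (not-involutive y)))
      in T , std , transposeT u₂ , o , transposeT T′ ,
         subst (λ q → OccB0 q (transposeT T′)) (sym (transpose-involutive-Standard _ u₂ std₂ᵤ)) o₂′ ,
         sym (transpose-involutive-Standard _ T′ std′)

  OccBBΣ⇔pattern : ∀ x y k T′ → Standard (4 + k) T′ →
    OccBBΣ x y k T′ ⇔ PatternB0 (x xor y) (view x (sub1234 T′))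
  OccBBΣ⇔pattern false y k T′ std′ = OccBBΣ-B0⇔pattern k y T′ std′
  OccBBΣ⇔pattern true  y k T′ std′ =
    ⇔.trans (OccBBΣ-B1⇔B0-transpose k y T′ std′)
      (subst (λ p → OccBBΣ false (not y) k (transposeT T′) ⇔ PatternB0 (not y) p)
             (sub1234-transpose _ T′ std′ (s≤s (s≤s (s≤s (s≤s z≤n)))))
             (OccBBΣ-B0⇔pattern k (not y) (transposeT T′) (transpose-Standard _ T′ std′)))

  OccBBΣ⇔table : ∀ x y k T′ → Standard (4 + k) T′ → OccBBΣ x y k T′ ⇔ sub1234 T′ ∈ table x y
  OccBBΣ⇔table x y k T′ std′ = ⇔.trans (OccBBΣ⇔pattern x y k T′ std′)
    (patternB0⇔table x y (sub1234 T′) (sub1234-permutation _ T′ std′ 4≤4+k)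
      (proj₁ (sub1234-standard _ T′ std′ 4≤4+k)))
    where
    4≤4+k : 4 ≤ 4 + k
    4≤4+k = s≤s (s≤s (s≤s (s≤s z≤n)))

open Occurrence using (OccBBΣ⇔table)

lemma19 : (n : ℕ) → 4 ≤ n → (T' : Tableau) → Standard n T' →
    (OccBBΣ false false (n ∸ 4) T' ⇔
        (sub1234 T' ∈ ((1 ∷ 2 ∷ 3 ∷ 4 ∷ []) ∷ (4 ∷ 1 ∷ 2 ∷ 3 ∷ []) ∷ (3 ∷ 4 ∷ 1 ∷ 2 ∷ []) ∷ [])))
    × (OccBBΣ false true (n ∸ 4) T' ⇔
        (sub1234 T' ∈ ((4 ∷ 3 ∷ 1 ∷ 2 ∷ []) ∷ (3 ∷ 1 ∷ 2 ∷ 4 ∷ []) ∷ [])))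
    × (OccBBΣ true false (n ∸ 4) T' ⇔
        (sub1234 T' ∈ ((4 ∷ 2 ∷ 1 ∷ 3 ∷ []) ∷ (2 ∷ 1 ∷ 3 ∷ 4 ∷ []) ∷ [])))
    × (OccBBΣ true true (n ∸ 4) T' ⇔
        (sub1234 T' ∈ ((4 ∷ 3 ∷ 2 ∷ 1 ∷ []) ∷ (3 ∷ 2 ∷ 1 ∷ 4 ∷ []) ∷ (2 ∷ 4 ∷ 1 ∷ 3 ∷ []) ∷ [])))
lemma19 .(4 + k) (s≤s (s≤s (s≤s (s≤s {n = k} _)))) T' std =
  OccBBΣ⇔table false false k T' std , OccBBΣ⇔table false true k T' std ,
  OccBBΣ⇔table true false k T' std , OccBBΣ⇔table true true k T' std
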